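{- Let $N$ be a positive integer and let $\varepsilon_\infty$ and $\varepsilon_\infty^+$ denote the number of cusps of $X_{\mathrm{ns}}(N)$ and $X_{\mathrm{ns}}^+(N)$, respectively. Then $\varepsilon_\infty=\varphi(N)$, and $\varepsilon_\infty^+=1$ if $N=2$ and $\varepsilon_\infty^+=\varphi(N)/2$ otherwise.
   Context: $\varphi$ is Euler's totient function. Let $R=\mathbb Z[\alpha]$ where $\alpha$ is a root of an irreducible monic polynomial $X^2-uX+v\in\mathbb Z[X]$, with discriminant of $R$ coprime to $N$ and every prime dividing $N$ inert in $R$. Then $A=R/NR=(\mathbb Z/N\mathbb Z)[\alpha]$ is free of rank 2 over $\mathbb Z/N\mathbb Z$ with basis $\{1,\alpha\}$, and multiplication maps give an embedding $A^\times\hookrightarrow \operatorname{GL}_2(\mathbb Z/N\mathbb Z)$ whose image is the non-split Cartan subgroup $C_{\mathrm{ns}}(N)$. Let $S_N$ be the ring involution of $A$ with $S_N(\alpha)=u-\alpha$; $C_{\mathrm{ns}}^+(N)$ is the subgroup of $\operatorname{GL}_2(\mathbb Z/N\mathbb Z)$ generated by $C_{\mathrm{ns}}(N)$ and $S_N$. For a subgroup $H \leq \operatorname{GL}_2(\mathbb Z/N\mathbb Z)$, let $\Gamma_H\subseteq \operatorname{SL}_2(\mathbb Z)$ be the matrices whose reduction mod $N$ lies in $H$, $X_H=\Gamma_H\backslash(\mathbb H\cup\mathbb P^1(\mathbb Q))$, and the cusps of $X_H$ are the $\Gamma_H$-orbits on $\mathbb P^1(\mathbb Q)$. $X_{\mathrm{ns}}(N)=X_{C_{\mathrm{ns}}(N)}$,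 $X_{\mathrm{ns}}^+(N)=X_{C_{\mathrm{ns}}^+(N)}$. -}

module Defs where

open import Data.Nat as ℕ using (ℕ; zero; suc)
open import Data.Nat.GCD using (gcd)
open import Data.Nat.Divisibility using () renaming (_∣_ to _∣ℕ_)
open import Data.Nat.Primality using (Prime)
open import Data.Integer as ℤ using (ℤ; +_; -_; _+_; _-_; _*_; ∣_∣)
open import Data.Fin using (Fin)
open import Data.List using (List; length; filter; upTo)
open import Data.Product using (Σ; ∃; _×_; _,_)
open import Data.Sum using (_⊎_)
open import Relation.Nullary using (¬_)
open import Relation.Binary.PropositionalEquality using (_≡_)
open import Function.Bundles using (_⇔_)

φ : ℕ → ℕ
φ N = length (filter (λ k → gcd k N ℕ.≟ 1) (upTo N))

infix 4 _≡_[mod_]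
_≡_[mod_] : ℤ → ℤ → ℕ → Set
x ≡ y [mod N ] = ∃ λ (k : ℤ) → x - y ≡ k * (+ N)

-- The quadratic order R = ℤ[α], α root of X² - uX + v

disc : ℤ → ℤ → ℤ
disc u v = u * u - (+ 4) * v

-- X² - uX + v is reducible over ℤ: it factors as (X - a)(X - b)
-- (for a monic quadratic, any nontrivial factorisation is into
--  two monic linear factors, up to signs)
ReducibleOverℤ : ℤ → ℤ → Set
ReducibleOverℤ u v = ∃ λ a → ∃ λ b → (a + b ≡ u) × (a * b ≡ v)

IrreducibleOverℤ : ℤ → ℤ → Set
IrreducibleOverℤ u v = ¬ ReducibleOverℤ u v

ReducibleMod : ℤ → ℤ → ℕ → Set
ReducibleMod u v p =
  ∃ λ a → ∃ λ b → (a + b ≡ u [mod p ]) × (a * b ≡ v [mod p ])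

-- the prime p is inert in R = ℤ[α]: R/pR = 𝔽_p[X]/(X² - uX + v) is a
-- field, i.e. X² - uX + v is irreducible mod p
Inert : ℤ → ℤ → ℕ → Set
Inert u v p = ¬ ReducibleMod u v p

record Admissible (u v : ℤ) (N : ℕ) : Set where
  field
    irreducible : IrreducibleOverℤ u v
    discCoprime : gcd ∣ disc u v ∣ N ≡ 1
    allInert    : ∀ p → Prime p → p ∣ℕ N → Inert u v p

record M2 : Set where
  constructor mat
  field
    a b c d : ℤ

open M2 public

infixl 7 _·_
_·_ : M2 → M2 → M2
mat a b c d · mat a' b' c' d' =
  mat (a * a' + b * c') (a * b' + b * d') (c * a' + d * c') (c * b' + d * d')

I₂ : M2
I₂ = mat (+ 1) (+ 0) (+ 0) (+ 1)

det : M2 → ℤ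
det (mat a b c d) = a * d - b * c

infix 4 _≡ₘ_[mod_]
_≡ₘ_[mod_] : M2 → M2 → ℕ → Set
M ≡ₘ M' [mod N ] =
  (a M ≡ a M' [mod N ]) × (b M ≡ b M' [mod N ]) ×
  (c M ≡ c M' [mod N ]) × (d M ≡ d M' [mod N ])

-- matrix of multiplication by x + yα on A = (ℤ/N)[α] in the basis {1, α}
-- (columns are the images of 1 and α; α² = uα - v)
mulMat : ℤ → ℤ → ℤ → ℤ → M2
mulMat u v x y = mat x (- (y * v)) y (x + y * u)

IsUnitA : ℤ → ℤ → ℕ → ℤ → ℤ → Set
IsUnitA u v N x y =
  ∃ λ x' → ∃ λ y' → (mulMat u v x y · mulMat u v x' y') ≡ₘ I₂ [mod N ]

InCns : ℤ → ℤ → ℕ → M2 → Set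
InCns u v N M =
  ∃ λ x → ∃ λ y → IsUnitA u v N x y × (M ≡ₘ mulMat u v x y [mod N ])

-- the involution S_N : 1 ↦ 1, α ↦ u - α
S-mat : ℤ → M2
S-mat u = mat (+ 1) u (+ 0) (- (+ 1))

data InCns⁺ (u v : ℤ) (N : ℕ) : M2 → Set where
  gen-C   : ∀ {M} → InCns u v N M → InCns⁺ u v N M
  gen-S   : ∀ {M} → M ≡ₘ S-mat u [mod N ] → InCns⁺ u v N M
  gen-mul : ∀ {M M'} → InCns⁺ u v N M → InCns⁺ u v N M' →
            InCns⁺ u v N (M · M')
  gen-inv : ∀ {M M'} → InCns⁺ u v N M → (M' · M) ≡ₘ I₂ [mod N ] →
            InCns⁺ u v N M'
  gen-cong : ∀ {M M'} → InCns⁺ u v N M → M ≡ₘ M' [mod N ] →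
             InCns⁺ u v N M'

-- P¹(ℚ) as primitive integer pairs (a : c), identified up to sign

record P1Q : Set where
  constructor pt
  field
    num den : ℤ
    prim : gcd ∣ num ∣ ∣ den ∣ ≡ 1

open P1Q public

act-num act-den : M2 → P1Q → ℤ
act-num (mat p q r s) x = p * num x + q * den x
act-den (mat p q r s) x = r * num x + s * den x

ActsTo : M2 → P1Q → P1Q → Set
ActsTo γ x y =
  ((act-num γ x ≡ num y) × (act-den γ x ≡ den y)) ⊎
  ((act-num γ x ≡ - num y) × (act-den γ x ≡ - den y))

InΓ : (M2 → Set) → M2 → Set
InΓ H γ = (det γ ≡ + 1) × H γ

SameCusp : (M2 → Set) → P1Q → P1Q → Set
SameCusp H x y = ∃ λ γ → InΓ H γ × ActsTo γ x y

-- X_H has exactly k cusps: the Γ_H-orbits on P¹(ℚ) are in bijection with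
-- Fin k (a surjection P¹(ℚ) → Fin k whose fibres are exactly the orbits)
NumCusps : (M2 → Set) → ℕ → Set
NumCusps H k =
  Σ (P1Q → Fin k) λ f →
    (∀ i → ∃ λ x → f x ≡ i) ×
    (∀ x y → (f x ≡ f y) ⇔ SameCusp H x y)

-- The invariant of a cusp (a : c) is the norm N(a + cα) = a² + uac + vc², a unit mod N
-- because every prime of N is inert in ℤ[α]. An element of Γ_ns(N) acts as multiplication
-- by some z ∈ A of norm det = 1 and so preserves it mod N, while the elements z · S_N of
-- Γ_ns⁺(N) have N(z) = -1 and change its sign. Conversely, if N(y) ≡ ±N(x), then y x̄ / N(x)
-- (resp. y x / N(x) followed by S_N) maps x to y modulo N and lifts to SL₂(ℤ). Finally every
-- unit is the norm of a primitive vector (squares mod p, Hensel and CRT), so the cusps of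
-- X_ns(N) correspond to (ℤ/N)^× and those of X_ns⁺(N) to (ℤ/N)^× / {±1}.

module Submission where

open import Defs
open import Data.Bool using (true; false)
open import Data.Empty using (⊥; ⊥-elim)
open import Data.Fin as Fin using (Fin; toℕ; fromℕ<; splitAt; join)
import Data.Fin.Properties as Fin
open import Data.Integer as ℤ using (ℤ; +_; -_; _+_; _-_; _*_; ∣_∣; 0ℤ; 1ℤ; -1ℤ; _%ℕ_; _/ℕ_)
import Data.Integer.Properties as ℤ
open import Data.Integer.DivMod using (a≡a%ℕn+[a/ℕn]*n; n%ℕd<d)
open import Data.Integer.Divisibility.Signed as ℤ∣ using () renaming (_∣_ to _∣ℤ_)
open import Data.Integer.Tactic.RingSolver using (solve-∀)
open import Data.List using (List; []; _∷_; _∷ʳ_; length; lookup; filter; upTo; applyUpTo)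
open import Data.List.Membership.Propositional using (_∈_)
open import Data.List.Membership.Propositional.Properties using (∈-lookup; ∈-filter⁺; ∈-filter⁻; ∈-upTo⁺; ∈-upTo⁻)
import Data.List.Membership.Setoid.Properties as Membership
open import Data.List.Properties using (length-++; filter-++; filter-reject; applyUpTo-∷ʳ)
open import Data.List.Relation.Unary.All using (All; []; _∷_)
import Data.List.Relation.Unary.All.Properties as All
open import Data.List.Relation.Unary.Any using (index)
open import Data.List.Relation.Unary.Unique.Propositional using (Unique)
open import Data.List.Relation.Unary.Unique.Propositional.Properties using (filter⁺; upTo⁺)
open import Data.Nat as ℕ using (ℕ; zero; suc; _∸_; _⊓_; _<_; _≤_; _<?_; _/_; s≤s; z≤n; NonZero)
import Data.Nat.Properties as ℕ
open import Data.Nat.Coprimality using (coprime-Bézout; gcd≡1⇒coprime)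
open import Data.Nat.DivMod using (m%n<n; m≡m%n+[m/n]*n; m*n/n≡m)
open import Data.Nat.Divisibility
  using (_∣_; _∣?_; divides; ∣-refl; ∣-trans; ∣1⇒≡1; _∣0; >⇒∤; ∣m+n∣m⇒∣n; m*n∣⇒m∣; m*n∣⇒n∣)
open import Data.Nat.GCD using (gcd; gcd[m,n]∣m; gcd[m,n]∣n; gcd-greatest; gcd-comm; gcd-identityˡ; module Bézout)
open import Data.Nat.ListAction using (product)
open import Data.Nat.ListAction.Properties using (∈⇒∣product)
open import Data.Nat.Primality using (Prime; euclidsLemma; prime⇒irreducible; prime[2]; ¬prime[1])
open import Data.Nat.Primality.Factorisation using (PrimeFactorisation; factorise; factorisationHasAllPrimeFactors)
open import Data.Product using (∃; ∃₂; _×_; _,_; proj₁; proj₂)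
open import Data.Sum using (_⊎_; inj₁; inj₂; [_,_]′; reduce)
open import Function using (_∘_)
open import Function.Bundles using (_⇔_; mk⇔; Equivalence)
open import Level using (0ℓ)
open import Relation.Binary.Bundles using (Setoid)
open import Relation.Binary.Structures using (IsEquivalence)
open import Relation.Binary.PropositionalEquality
open import Relation.Nullary using (¬_; Dec; does; yes; no; _×-dec_; ¬?)
open import Relation.Unary using (Pred; Decidable)

-- Congruences

-- A record rather than the Σ-type of Defs, so that x, y and n can be inferred.
infix 4 _≈_[mod_]
record _≈_[mod_] (x y : ℤ) (n : ℕ) : Set where
  constructor congruent
  field divides-diff : + n ∣ℤ x - y

open _≈_[mod_] public

≈⇒≡[mod] : ∀ {x y n} → x ≈ y [mod n ] → x ≡ y [mod n ]
≈⇒≡[mod] (congruent (ℤ∣.divides k eq)) = k , eq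

≡[mod]⇒≈ : ∀ {x y n} → x ≡ y [mod n ] → x ≈ y [mod n ]
≡[mod]⇒≈ (k , eq) = congruent (ℤ∣.divides k eq)

private
  diff-self : ∀ x m → x - x ≡ 0ℤ * m
  diff-self = solve-∀

  diff-neg : ∀ x y → - (x - y) ≡ y - x
  diff-neg = solve-∀

  diff-‿ : ∀ x x' → - (x - x') ≡ - x - - x'
  diff-‿ = solve-∀

  diff-trans : ∀ x y z → (x - y) + (y - z) ≡ x - z
  diff-trans = solve-∀

  diff-+ : ∀ x x' y y' → (x - x') + (y - y') ≡ (x + y) - (x' + y')
  diff-+ = solve-∀

  diff-cancel : ∀ k x y → (k + x) - (k + y) ≡ x - y
  diff-cancel = solve-∀

  diff-* : ∀ x x' y y' → x * (y - y') + (x - x') * y' ≡ x * y - x' * y'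
  diff-* = solve-∀

module _ {n : ℕ} where

  ≈-reflexive : ∀ {x y} → x ≡ y → x ≈ y [mod n ]
  ≈-reflexive {x} refl = congruent (ℤ∣.divides 0ℤ (diff-self x (+ n)))

  ≈-refl : ∀ {x} → x ≈ x [mod n ]
  ≈-refl = ≈-reflexive refl

  ≈-sym : ∀ {x y} → x ≈ y [mod n ] → y ≈ x [mod n ]
  ≈-sym {x} {y} (congruent d) =
    congruent (subst (+ n ∣ℤ_) (diff-neg x y) (ℤ∣.∣m⇒∣-m d))

  ≈-trans : ∀ {x y z} → x ≈ y [mod n ] → y ≈ z [mod n ] → x ≈ z [mod n ]
  ≈-trans {x} {y} {z} (congruent d) (congruent d') =
    congruent (subst (+ n ∣ℤ_) (diff-trans x y z) (ℤ∣.∣m∣n⇒∣m+n d d'))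

  +-cong : ∀ {x x' y y'} → x ≈ x' [mod n ] → y ≈ y' [mod n ] → x + y ≈ x' + y' [mod n ]
  +-cong {x} {x'} {y} {y'} (congruent d) (congruent d') =
    congruent (subst (+ n ∣ℤ_) (diff-+ x x' y y') (ℤ∣.∣m∣n⇒∣m+n d d'))

  -‿cong : ∀ {x x'} → x ≈ x' [mod n ] → - x ≈ - x' [mod n ]
  -‿cong {x} {x'} (congruent d) =
    congruent (subst (+ n ∣ℤ_) (diff-‿ x x') (ℤ∣.∣m⇒∣-m d))

  *-cong : ∀ {x x' y y'} → x ≈ x' [mod n ] → y ≈ y' [mod n ] → x * y ≈ x' * y' [mod n ]
  *-cong {x} {x'} {y} {y'} (congruent d) (congruent d') =
    congruent (subst (+ n ∣ℤ_) (diff-* x x' y y')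
                     (ℤ∣.∣m∣n⇒∣m+n (ℤ∣.∣n⇒∣m*n x d') (ℤ∣.∣m⇒∣m*n y' d)))

  -‿-cong : ∀ {x x' y y'} → x ≈ x' [mod n ] → y ≈ y' [mod n ] → x - y ≈ x' - y' [mod n ]
  -‿-cong p q = +-cong p (-‿cong q)

  *-congˡ : ∀ z {x x'} → x ≈ x' [mod n ] → z * x ≈ z * x' [mod n ]
  *-congˡ z = *-cong (≈-refl {z})

  *-congʳ : ∀ z {x x'} → x ≈ x' [mod n ] → x * z ≈ x' * z [mod n ]
  *-congʳ z p = *-cong p (≈-refl {z})

  ∣⇒≈0 : ∀ {x} → + n ∣ℤ x → x ≈ 0ℤ [mod n ]
  ∣⇒≈0 {x} d = congruent (subst (+ n ∣ℤ_) (sym (ℤ.+-identityʳ x)) d)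

  ≈0⇒∣ : ∀ {x} → x ≈ 0ℤ [mod n ] → + n ∣ℤ x
  ≈0⇒∣ {x} (congruent d) = subst (+ n ∣ℤ_) (ℤ.+-identityʳ x) d

  ≈⇒diff≈0 : ∀ {x y} → x ≈ y [mod n ] → x - y ≈ 0ℤ [mod n ]
  ≈⇒diff≈0 x≈y = ∣⇒≈0 (divides-diff x≈y)

  +-cancelˡ : ∀ k {x y} → k + x ≈ k + y [mod n ] → x ≈ y [mod n ]
  +-cancelˡ k {x} {y} (congruent d) = congruent (subst (+ n ∣ℤ_) (diff-cancel k x y) d)

  multiple≈0 : ∀ k → k * + n ≈ 0ℤ [mod n ]
  multiple≈0 k = ∣⇒≈0 (ℤ∣.divides k refl)

≈-setoid : ℕ → Setoid _ _
≈-setoid n = record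
  { Carrier = ℤ
  ; _≈_ = λ x y → x ≈ y [mod n ]
  ; isEquivalence = record { refl = ≈-refl ; sym = ≈-sym ; trans = ≈-trans }
  }

module ≈-Reasoning (n : ℕ) where
  open import Relation.Binary.Reasoning.Setoid (≈-setoid n) public

≈-mod-∣ : ∀ {m n x y} → m ∣ n → x ≈ y [mod n ] → x ≈ y [mod m ]
≈-mod-∣ {m} (divides q refl) (congruent d) =
  congruent (ℤ∣.∣-trans (ℤ∣.divides (+ q) (ℤ.pos-* q m)) d)

≈[mod1] : ∀ x y → x ≈ y [mod 1 ]
≈[mod1] x y = congruent (ℤ∣.divides (x - y) (sym (ℤ.*-identityʳ (x - y))))

≈-mod-* : ∀ {m n x y} X → x - y ≡ + m * X → X ≈ 0ℤ [mod n ] → x ≈ y [mod m ℕ.* n ]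
≈-mod-* {m} {n} {x} {y} X x-y≡mX X≈0 with ≈0⇒∣ X≈0
... | ℤ∣.divides f X≡fn = congruent (ℤ∣.divides f (begin
  x - y              ≡⟨ x-y≡mX ⟩
  + m * X            ≡⟨ cong (+ m *_) X≡fn ⟩
  + m * (f * + n)    ≡⟨ regroup (+ m) f (+ n) ⟩
  f * (+ m * + n)    ≡⟨ cong (f *_) (ℤ.pos-* m n) ⟨
  f * + (m ℕ.* n)    ∎))
  where
    open ≡-Reasoning
    regroup : ∀ m f n → m * (f * n) ≡ f * (m * n)
    regroup = solve-∀

∃-prime-divisor : ∀ m → 1 < m → ∃ λ p → Prime p × p ∣ m
∃-prime-divisor m@(suc _) 1<m with factorise m
... | record { factors = [] ; isFactorisation = m≡1 } = ⊥-elim (ℕ.<⇒≢ 1<m (sym m≡1))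
... | record { factors = p ∷ ps ; isFactorisation = m≡p*ps ; factorsPrime = p-prime ∷ _ } =
  p , p-prime , divides (product ps) (trans m≡p*ps (ℕ.*-comm p (product ps)))

noCommonPrime⇒gcd≡1 : ∀ m n → (∀ p → Prime p → p ∣ m → p ∣ n → ⊥) → gcd m n ≡ 1
noCommonPrime⇒gcd≡1 m n noCommon with gcd m n | gcd[m,n]∣m m n | gcd[m,n]∣n m n
... | 0 | 0∣m | 0∣n = ⊥-elim (noCommon 2 prime[2] (∣-trans (2 ∣0) 0∣m) (∣-trans (2 ∣0) 0∣n))
... | 1 | _ | _ = refl
... | g@(suc (suc _)) | g∣m | g∣n with ∃-prime-divisor g (ℕ.s≤s (ℕ.s≤s ℕ.z≤n))
...   | p , p-prime , p∣g = ⊥-elim (noCommon p p-prime (∣-trans p∣g g∣m) (∣-trans p∣g g∣n))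

prime∤⇒gcd≡1 : ∀ {p n} → Prime p → ¬ p ∣ n → gcd p n ≡ 1
prime∤⇒gcd≡1 {p} {n} p-prime p∤n with prime⇒irreducible p-prime (gcd[m,n]∣m p n)
... | inj₁ g≡1 = g≡1
... | inj₂ g≡p = ⊥-elim (p∤n (subst (_∣ n) g≡p (gcd[m,n]∣n p n)))

prime≢1 : ∀ {p} → Prime p → p ≢ 1
prime≢1 p-prime refl = ¬prime[1] p-prime

euclidsLemmaℤ : ∀ {p} x y → Prime p → + p ∣ℤ x * y → + p ∣ℤ x ⊎ + p ∣ℤ y
euclidsLemmaℤ {p} x y p-prime p∣xy
  with euclidsLemma ∣ x ∣ ∣ y ∣ p-prime (subst (p ∣_) (ℤ.abs-* x y) (ℤ∣.∣⇒∣ᵤ p∣xy))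
... | inj₁ p∣x = inj₁ (ℤ∣.∣ᵤ⇒∣ p∣x)
... | inj₂ p∣y = inj₂ (ℤ∣.∣ᵤ⇒∣ p∣y)

record InvertibleMod (n : ℕ) (z : ℤ) : Set where
  constructor invertible
  field
    inverse : ℤ
    inverse-correct : z * inverse ≈ 1ℤ [mod n ]

open InvertibleMod public

invertible-resp-≈ : ∀ {n x y} → x ≈ y [mod n ] → InvertibleMod n y → InvertibleMod n x
invertible-resp-≈ {n} x≈y (invertible w yw≈1) = invertible w (≈-trans (*-congʳ w x≈y) yw≈1)

invertible⇒prime∤ : ∀ {n p z} → InvertibleMod n z → Prime p → p ∣ n → ¬ (+ p ∣ℤ z)
invertible⇒prime∤ {n} {p} {z} (invertible w zw≈1) p-prime p∣n p∣z =
  prime≢1 p-prime (∣1⇒≡1 (ℤ∣.∣⇒∣ᵤ (≈0⇒∣ 1≈0)))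
  where
    1≈0 : 1ℤ ≈ 0ℤ [mod p ]
    1≈0 = ≈-trans (≈-sym (≈-mod-∣ p∣n zw≈1)) (≈-trans (*-congʳ w (∣⇒≈0 p∣z)) (≈-reflexive refl))

invertible⇒gcd≡1 : ∀ {n} z → InvertibleMod n z → gcd ∣ z ∣ n ≡ 1
invertible⇒gcd≡1 {n} z inv = noCommonPrime⇒gcd≡1 ∣ z ∣ n
  λ p p-prime p∣z p∣n → invertible⇒prime∤ inv p-prime p∣n (ℤ∣.∣ᵤ⇒∣ p∣z)

gcd≡1⇒invertible-pos : ∀ {n} m → gcd m n ≡ 1 → InvertibleMod n (+ m)
gcd≡1⇒invertible-pos {n} m gcd≡1 with coprime-Bézout (gcd≡1⇒coprime gcd≡1)
... | Bézout.+- x y 1+yn≡xm = invertible (+ x) (congruent (ℤ∣.divides (+ y) (begin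
  + m * + x - 1ℤ         ≡⟨ cong (_- 1ℤ) (trans (ℤ.*-comm (+ m) (+ x)) (sym (ℤ.pos-* x m))) ⟩
  + (x ℕ.* m) - 1ℤ       ≡⟨ cong (λ t → + t - 1ℤ) (sym 1+yn≡xm) ⟩
  + (1 ℕ.+ y ℕ.* n) - 1ℤ ≡⟨ cong (_- 1ℤ) (trans (ℤ.pos-+ 1 (y ℕ.* n)) (cong (λ t → 1ℤ + t) (ℤ.pos-* y n))) ⟩
  1ℤ + + y * + n - 1ℤ    ≡⟨ cancel-one (+ y * + n) ⟩
  + y * + n              ∎)))
  where
    open ≡-Reasoning
    cancel-one : ∀ t → 1ℤ + t - 1ℤ ≡ t
    cancel-one = solve-∀
... | Bézout.-+ x y 1+xm≡yn = invertible (- + x) (congruent (ℤ∣.divides (- + y) (begin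
  + m * - + x - 1ℤ         ≡⟨ negate (+ m) (+ x) ⟩
  - (1ℤ + + x * + m)       ≡⟨ cong (λ t → - (1ℤ + t)) (sym (ℤ.pos-* x m)) ⟩
  - (1ℤ + + (x ℕ.* m))     ≡⟨ cong -_ (sym (ℤ.pos-+ 1 (x ℕ.* m))) ⟩
  - + (1 ℕ.+ x ℕ.* m)      ≡⟨ cong (λ t → - + t) 1+xm≡yn ⟩
  - + (y ℕ.* n)            ≡⟨ cong -_ (ℤ.pos-* y n) ⟩
  - (+ y * + n)            ≡⟨ ℤ.neg-distribˡ-* (+ y) (+ n) ⟩
  - + y * + n              ∎)))
  where
    open ≡-Reasoning
    negate : ∀ a b → a * - b - 1ℤ ≡ - (1ℤ + b * a)
    negate = solve-∀

gcd≡1⇒invertible : ∀ {n} z → gcd ∣ z ∣ n ≡ 1 → InvertibleMod n z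
gcd≡1⇒invertible {n} z gcd≡1 with ℤ.+∣i∣≡i⊎+∣i∣≡-i z | gcd≡1⇒invertible-pos ∣ z ∣ gcd≡1
... | inj₁ +∣z∣≡z  | inv = subst (InvertibleMod n) +∣z∣≡z inv
... | inj₂ +∣z∣≡-z | invertible w ∣z∣w≈1 =
  invertible (- w) (≈-trans (≈-reflexive (sign-swap z w)) (subst (λ t → t * w ≈ 1ℤ [mod n ]) +∣z∣≡-z ∣z∣w≈1))
  where
    sign-swap : ∀ z w → z * - w ≡ - z * w
    sign-swap = solve-∀

prime∤⇒invertible : ∀ {p} x → Prime p → ¬ (+ p ∣ℤ x) → InvertibleMod p x
prime∤⇒invertible {p} x p-prime p∤x =
  gcd≡1⇒invertible x (trans (gcd-comm ∣ x ∣ p) (prime∤⇒gcd≡1 p-prime (λ p∣x → p∤x (ℤ∣.∣ᵤ⇒∣ p∣x))))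

small-≈⇒≡ : ∀ {n a b} → a < n → b < n → + a ≈ + b [mod n ] → a ≡ b
small-≈⇒≡ {n} {a} {b} a<n b<n (congruent n∣a-b) with ∣ + a - + b ∣ in eq | ℤ∣.∣⇒∣ᵤ n∣a-b
... | zero  | _   = ℤ.+-injective (ℤ.i-j≡0⇒i≡j (+ a) (+ b) (ℤ.∣i∣≡0⇒i≡0 eq))
... | suc t | n∣t = ⊥-elim (>⇒∤ (subst (_< n) eq ∣a-b∣<n) n∣t)
  where
    ∣a-b∣<n : ∣ + a - + b ∣ < n
    ∣a-b∣<n = ℕ.≤-<-trans (subst (ℕ._≤ a ℕ.⊔ b) (cong ∣_∣ (sym (ℤ.[+m]-[+n]≡m⊖n a b))) (ℤ.∣m⊝n∣≤m⊔n a b))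
                          (ℕ.⊔-lub a<n b<n)

module _ {n : ℕ} .{{_ : NonZero n}} where

  ≈-%ℕ : ∀ z → z ≈ + (z %ℕ n) [mod n ]
  ≈-%ℕ z = congruent (ℤ∣.divides (z /ℕ n) (begin
    z - + (z %ℕ n)                                ≡⟨ cong (_- + (z %ℕ n)) (a≡a%ℕn+[a/ℕn]*n z n) ⟩
    + (z %ℕ n) + (z /ℕ n) * + n - + (z %ℕ n)      ≡⟨ cancel (+ (z %ℕ n)) ((z /ℕ n) * + n) ⟩
    (z /ℕ n) * + n                                ∎))
    where
      open ≡-Reasoning
      cancel : ∀ r m → r + m - r ≡ m
      cancel = solve-∀

  ≈⇒%ℕ≡ : ∀ {z z'} → z ≈ z' [mod n ] → z %ℕ n ≡ z' %ℕ n
  ≈⇒%ℕ≡ {z} {z'} z≈z' = small-≈⇒≡ (n%ℕd<d z n) (n%ℕd<d z' n)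
    (≈-trans (≈-sym (≈-%ℕ z)) (≈-trans z≈z' (≈-%ℕ z')))

  %ℕ≡⇒≈ : ∀ {z z'} → z %ℕ n ≡ z' %ℕ n → z ≈ z' [mod n ]
  %ℕ≡⇒≈ {z} {z'} eq = ≈-trans (≈-%ℕ z) (≈-trans (≈-reflexive (cong +_ eq)) (≈-sym (≈-%ℕ z')))

  small-%ℕ : ∀ {k} → k < n → + k %ℕ n ≡ k
  small-%ℕ {k} k<n = small-≈⇒≡ (n%ℕd<d (+ k) n) k<n (≈-sym (≈-%ℕ (+ k)))

  neg-%ℕ : ∀ z → 0 < z %ℕ n → (- z) %ℕ n ≡ n ∸ z %ℕ n
  neg-%ℕ z 0<r = trans (≈⇒%ℕ≡ -z≈n-r) (small-%ℕ (ℕ.∸-monoʳ-< 0<r (ℕ.<⇒≤ (n%ℕd<d z n))))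
    where
      r = z %ℕ n
      -r≈n-r : - + r ≈ + (n ∸ r) [mod n ]
      -r≈n-r = congruent (ℤ∣.divides (- 1ℤ) (begin
        - + r - + (n ∸ r)         ≡⟨ negate (+ r) (+ (n ∸ r)) ⟩
        - (+ (n ∸ r) + + r)       ≡⟨ cong -_ (ℤ.pos-+ (n ∸ r) r) ⟨
        - + (n ∸ r ℕ.+ r)         ≡⟨ cong (λ t → - + t) (ℕ.m∸n+n≡m (ℕ.<⇒≤ (n%ℕd<d z n))) ⟩
        - + n                     ≡⟨ ℤ.-1*i≡-i (+ n) ⟨
        - 1ℤ * + n                ∎))
        where
          open ≡-Reasoning
          negate : ∀ a b → - a - b ≡ - (b + a)
          negate = solve-∀
      -z≈n-r : - z ≈ + (n ∸ r) [mod n ]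
      -z≈n-r = ≈-trans (-‿cong (≈-%ℕ z)) -r≈n-r

*-cancelˡ-invertible : ∀ {n k x y} → InvertibleMod n k → k * x ≈ k * y [mod n ] → x ≈ y [mod n ]
*-cancelˡ-invertible {n} {k} {x} {y} (invertible w kw≈1) kx≈ky = begin
  x                 ≡⟨ ℤ.*-identityˡ x ⟨
  1ℤ * x            ≈⟨ *-congʳ x (≈-sym kw≈1) ⟩
  k * w * x         ≡⟨ swap k w x ⟩
  w * (k * x)       ≈⟨ *-congˡ w kx≈ky ⟩
  w * (k * y)       ≡⟨ swap k w y ⟨
  k * w * y         ≈⟨ *-congʳ y kw≈1 ⟩
  1ℤ * y            ≡⟨ ℤ.*-identityˡ y ⟩
  y                 ∎
  where
    open ≈-Reasoning n
    swap : ∀ k w x → k * w * x ≡ w * (k * x)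
    swap = solve-∀

crt-unique : ∀ {p q x y} → InvertibleMod q (+ p) → x ≈ y [mod p ] → x ≈ y [mod q ] →
             x ≈ y [mod q ℕ.* p ]
crt-unique {p} {q} {x} {y} p⁻¹ (congruent (ℤ∣.divides k x-y≡kp)) x≈y[q] = lift (≈0⇒∣ k≈0)
  where
    k≈0 : k ≈ 0ℤ [mod q ]
    k≈0 = *-cancelˡ-invertible p⁻¹ (begin
      + p * k    ≡⟨ ℤ.*-comm (+ p) k ⟩
      k * + p    ≡⟨ x-y≡kp ⟨
      x - y      ≈⟨ ≈⇒diff≈0 x≈y[q] ⟩
      0ℤ         ≡⟨ ℤ.*-zeroʳ (+ p) ⟨
      + p * 0ℤ   ∎)
      where open ≈-Reasoning q
    lift : + q ∣ℤ k → x ≈ y [mod q ℕ.* p ]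
    lift (ℤ∣.divides l k≡lq) = congruent (ℤ∣.divides l (begin
      x - y              ≡⟨ x-y≡kp ⟩
      k * + p            ≡⟨ cong (_* + p) k≡lq ⟩
      l * + q * + p      ≡⟨ ℤ.*-assoc l (+ q) (+ p) ⟩
      l * (+ q * + p)    ≡⟨ cong (l *_) (ℤ.pos-* q p) ⟨
      l * + (q ℕ.* p)    ∎))
      where open ≡-Reasoning

crt-exists : ∀ {p q} → InvertibleMod q (+ p) → ∀ x y → ∃ λ z → z ≈ x [mod p ] × z ≈ y [mod q ]
crt-exists {p} {q} (invertible w pw≈1) x y = z , z≈x , z≈y
  where
    z = x + (y - x) * (+ p * w)
    z≈x : z ≈ x [mod p ]
    z≈x = begin
      x + (y - x) * (+ p * w)     ≡⟨ regroup x (y - x) (+ p) w ⟩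
      x + (y - x) * w * + p       ≈⟨ +-cong (≈-refl {x = x}) (multiple≈0 ((y - x) * w)) ⟩
      x + 0ℤ                      ≡⟨ ℤ.+-identityʳ x ⟩
      x                           ∎
      where
        open ≈-Reasoning p
        regroup : ∀ x d p w → x + d * (p * w) ≡ x + d * w * p
        regroup = solve-∀
    z≈y : z ≈ y [mod q ]
    z≈y = begin
      x + (y - x) * (+ p * w)     ≈⟨ +-cong (≈-refl {x = x}) (*-congˡ (y - x) pw≈1) ⟩
      x + (y - x) * 1ℤ            ≡⟨ cancel x y ⟩
      y                           ∎
      where
        open ≈-Reasoning q
        cancel : ∀ x y → x + (y - x) * 1ℤ ≡ y
        cancel = solve-∀

-- 2 × 2 matrices and lifting to SL₂(ℤ)

ℤ² : Set
ℤ² = ℤ × ℤ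

infixr 6 _·ᵥ_
_·ᵥ_ : M2 → ℤ² → ℤ²
mat p q r s ·ᵥ (x , y) = p * x + q * y , r * x + s * y

e₁ : ℤ²
e₁ = 1ℤ , 0ℤ

Primitive : ℤ² → Set
Primitive (a , c) = gcd ∣ a ∣ ∣ c ∣ ≡ 1

adj : M2 → M2
adj (mat p q r s) = mat s (- q) (- r) p

scalar : ℤ → M2
scalar k = mat k 0ℤ 0ℤ k

mat-cong : ∀ {a b c d a' b' c' d'} → a ≡ a' → b ≡ b' → c ≡ c' → d ≡ d' →
           mat a b c d ≡ mat a' b' c' d'
mat-cong refl refl refl refl = refl

private
  row·col-assoc : ∀ x₁ x₂ y₁₁ y₁₂ y₂₁ y₂₂ z₁ z₂ →
    (x₁ * y₁₁ + x₂ * y₂₁) * z₁ + (x₁ * y₁₂ + x₂ * y₂₂) * z₂ ≡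
    x₁ * (y₁₁ * z₁ + y₁₂ * z₂) + x₂ * (y₂₁ * z₁ + y₂₂ * z₂)
  row·col-assoc = solve-∀

  pick₁ˡ : ∀ x y → 1ℤ * x + 0ℤ * y ≡ x
  pick₁ˡ = solve-∀

  pick₂ˡ : ∀ x y → 0ℤ * x + 1ℤ * y ≡ y
  pick₂ˡ = solve-∀

  pick₁ʳ : ∀ x y → x * 1ℤ + y * 0ℤ ≡ x
  pick₁ʳ = solve-∀

  pick₂ʳ : ∀ x y → x * 0ℤ + y * 1ℤ ≡ y
  pick₂ʳ = solve-∀

  adj-diag₁ : ∀ p q r s → s * p + - q * r ≡ p * s - q * r
  adj-diag₁ = solve-∀

  adj-diag₂ : ∀ p q r s → - r * q + p * s ≡ p * s - q * r
  adj-diag₂ = solve-∀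

  adj-off₁ : ∀ x y → x * y + - y * x ≡ 0ℤ
  adj-off₁ = solve-∀

  adj-off₂ : ∀ x y → - x * y + y * x ≡ 0ℤ
  adj-off₂ = solve-∀

·-assoc : ∀ A B C → (A · B) · C ≡ A · (B · C)
·-assoc (mat a b c d) (mat a' b' c' d') (mat a'' b'' c'' d'') =
  mat-cong (row·col-assoc a b a' b' c' d' a'' c'') (row·col-assoc a b a' b' c' d' b'' d'')
           (row·col-assoc c d a' b' c' d' a'' c'') (row·col-assoc c d a' b' c' d' b'' d'')

·-identityˡ : ∀ A → I₂ · A ≡ A
·-identityˡ (mat a b c d) = mat-cong (pick₁ˡ a c) (pick₁ˡ b d) (pick₂ˡ a c) (pick₂ˡ b d)

·-identityʳ : ∀ A → A · I₂ ≡ A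
·-identityʳ (mat a b c d) = mat-cong (pick₁ʳ a b) (pick₂ʳ a b) (pick₁ʳ c d) (pick₂ʳ c d)

det-· : ∀ A B → det (A · B) ≡ det A * det B
det-· (mat a b c d) (mat a' b' c' d') = multiplicative a b c d a' b' c' d'
  where
    multiplicative : ∀ a b c d a' b' c' d' →
      (a * a' + b * c') * (c * b' + d * d') - (a * b' + b * d') * (c * a' + d * c') ≡
      (a * d - b * c) * (a' * d' - b' * c')
    multiplicative = solve-∀

·-·ᵥ : ∀ A B w → (A · B) ·ᵥ w ≡ A ·ᵥ B ·ᵥ w
·-·ᵥ (mat a b c d) (mat a' b' c' d') (x , y) =
  cong₂ _,_ (row·col a b a' b' c' d' x y) (row·col c d a' b' c' d' x y)
  where
    row·col : ∀ a b a' b' c' d' x y →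
      (a * a' + b * c') * x + (a * b' + b * d') * y ≡ a * (a' * x + b' * y) + b * (c' * x + d' * y)
    row·col = solve-∀

·ᵥ-e₁ : ∀ A → A ·ᵥ e₁ ≡ (a A , c A)
·ᵥ-e₁ (mat a b c d) = cong₂ _,_ (pick₁ʳ a b) (pick₁ʳ c d)

adj-· : ∀ A → adj A · A ≡ scalar (det A)
adj-· (mat p q r s) =
  mat-cong (adj-diag₁ p q r s) (adj-off₁ s q) (adj-off₂ r p) (adj-diag₂ p q r s)

adj-involutive : ∀ A → adj (adj A) ≡ A
adj-involutive (mat p q r s) = mat-cong refl (ℤ.neg-involutive q) (ℤ.neg-involutive r) refl

det-adj : ∀ A → det (adj A) ≡ det A
det-adj (mat p q r s) = same p q r s
  where
    same : ∀ p q r s → s * p - - q * - r ≡ p * s - q * r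
    same = solve-∀

·-adj : ∀ A → A · adj A ≡ scalar (det A)
·-adj A = begin
  A · adj A             ≡⟨ cong (_· adj A) (adj-involutive A) ⟨
  adj (adj A) · adj A   ≡⟨ adj-· (adj A) ⟩
  scalar (det (adj A))  ≡⟨ cong scalar (det-adj A) ⟩
  scalar (det A)        ∎
  where open ≡-Reasoning

adj-·-SL₂ : ∀ A → det A ≡ 1ℤ → adj A · A ≡ I₂
adj-·-SL₂ A det≡1 = trans (adj-· A) (cong scalar det≡1)

·-adj-SL₂ : ∀ A → det A ≡ 1ℤ → A · adj A ≡ I₂
·-adj-SL₂ A det≡1 = trans (·-adj A) (cong scalar det≡1)

infix 4 _≈ₘ_[mod_] _≈ᵥ_[mod_]
record _≈ₘ_[mod_] (M M' : M2) (n : ℕ) : Set where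
  constructor mat-≈
  field
    a-≈ : a M ≈ a M' [mod n ]
    b-≈ : b M ≈ b M' [mod n ]
    c-≈ : c M ≈ c M' [mod n ]
    d-≈ : d M ≈ d M' [mod n ]

record _≈ᵥ_[mod_] (w w' : ℤ²) (n : ℕ) : Set where
  constructor vec-≈
  field
    fst-≈ : proj₁ w ≈ proj₁ w' [mod n ]
    snd-≈ : proj₂ w ≈ proj₂ w' [mod n ]

≈ₘ⇒≡ₘ : ∀ {M M' n} → M ≈ₘ M' [mod n ] → M ≡ₘ M' [mod n ]
≈ₘ⇒≡ₘ (mat-≈ p q r s) = ≈⇒≡[mod] p , ≈⇒≡[mod] q , ≈⇒≡[mod] r , ≈⇒≡[mod] s

≡ₘ⇒≈ₘ : ∀ {M M' n} → M ≡ₘ M' [mod n ] → M ≈ₘ M' [mod n ]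
≡ₘ⇒≈ₘ (p , q , r , s) = mat-≈ (≡[mod]⇒≈ p) (≡[mod]⇒≈ q) (≡[mod]⇒≈ r) (≡[mod]⇒≈ s)

module _ {n : ℕ} where

  ≈ₘ-reflexive : ∀ {M M'} → M ≡ M' → M ≈ₘ M' [mod n ]
  ≈ₘ-reflexive refl = mat-≈ ≈-refl ≈-refl ≈-refl ≈-refl

  ≈ₘ-refl : ∀ {M} → M ≈ₘ M [mod n ]
  ≈ₘ-refl = ≈ₘ-reflexive refl

  ≈ₘ-sym : ∀ {M M'} → M ≈ₘ M' [mod n ] → M' ≈ₘ M [mod n ]
  ≈ₘ-sym (mat-≈ p q r s) = mat-≈ (≈-sym p) (≈-sym q) (≈-sym r) (≈-sym s)

  ≈ₘ-trans : ∀ {M M' M''} → M ≈ₘ M' [mod n ] → M' ≈ₘ M'' [mod n ] → M ≈ₘ M'' [mod n ]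
  ≈ₘ-trans (mat-≈ p q r s) (mat-≈ p' q' r' s') =
    mat-≈ (≈-trans p p') (≈-trans q q') (≈-trans r r') (≈-trans s s')

  ≈ₘ-isEquivalence : IsEquivalence (λ M M' → M ≈ₘ M' [mod n ])
  ≈ₘ-isEquivalence = record { refl = ≈ₘ-refl ; sym = ≈ₘ-sym ; trans = ≈ₘ-trans }

  ·-cong : ∀ {A A' B B'} → A ≈ₘ A' [mod n ] → B ≈ₘ B' [mod n ] → A · B ≈ₘ A' · B' [mod n ]
  ·-cong (mat-≈ p q r s) (mat-≈ p' q' r' s') =
    mat-≈ (+-cong (*-cong p p') (*-cong q r')) (+-cong (*-cong p q') (*-cong q s'))
          (+-cong (*-cong r p') (*-cong s r')) (+-cong (*-cong r q') (*-cong s s'))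

  det-cong : ∀ {A A'} → A ≈ₘ A' [mod n ] → det A ≈ det A' [mod n ]
  det-cong (mat-≈ p q r s) = -‿-cong (*-cong p s) (*-cong q r)

  ≈ᵥ-reflexive : ∀ {w w'} → w ≡ w' → w ≈ᵥ w' [mod n ]
  ≈ᵥ-reflexive refl = vec-≈ ≈-refl ≈-refl

  ≈ᵥ-trans : ∀ {w w' w''} → w ≈ᵥ w' [mod n ] → w' ≈ᵥ w'' [mod n ] → w ≈ᵥ w'' [mod n ]
  ≈ᵥ-trans (vec-≈ p q) (vec-≈ p' q') = vec-≈ (≈-trans p p') (≈-trans q q')

  ·ᵥ-cong : ∀ {A A' w w'} → A ≈ₘ A' [mod n ] → w ≈ᵥ w' [mod n ] → A ·ᵥ w ≈ᵥ A' ·ᵥ w' [mod n ]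
  ·ᵥ-cong (mat-≈ p q r s) (vec-≈ x y) =
    vec-≈ (+-cong (*-cong p x) (*-cong q y)) (+-cong (*-cong r x) (*-cong s y))

≈ₘ-setoid : ℕ → Setoid _ _
≈ₘ-setoid n = record { isEquivalence = ≈ₘ-isEquivalence {n} }

module ≈ₘ-Reasoning (n : ℕ) where
  open import Relation.Binary.Reasoning.Setoid (≈ₘ-setoid n) public

private
  x-[x-1] : ∀ x → x - (x - 1ℤ) ≡ 1ℤ
  x-[x-1] = solve-∀

  signed-multiple : ∀ k c → ∃ λ b → b * c ≡ k * + ∣ c ∣
  signed-multiple k c with ℤ.+∣i∣≡i⊎+∣i∣≡-i c
  ... | inj₁ ∣c∣≡c  = k , cong (k *_) (sym ∣c∣≡c)
  ... | inj₂ ∣c∣≡-c = - k , trans (sym (ℤ.neg-distribˡ-* k c))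
                               (trans (ℤ.neg-distribʳ-* k c) (cong (k *_) (sym ∣c∣≡-c)))

SL₂-completion : ∀ w → Primitive w → ∃ λ γ → det γ ≡ 1ℤ × γ ·ᵥ e₁ ≡ w
SL₂-completion (a , c) a⊥c with gcd≡1⇒invertible a a⊥c
... | invertible d (congruent (ℤ∣.divides k ad-1≡k∣c∣)) with signed-multiple k c
...   | b , bc≡k∣c∣ = mat a b c d , det≡1 , ·ᵥ-e₁ (mat a b c d)
  where
    det≡1 : a * d - b * c ≡ 1ℤ
    det≡1 = begin
      a * d - b * c              ≡⟨ cong (λ t → a * d - t) (trans bc≡k∣c∣ (sym ad-1≡k∣c∣)) ⟩
      a * d - (a * d - 1ℤ)       ≡⟨ x-[x-1] (a * d) ⟩
      1ℤ                         ∎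
      where open ≡-Reasoning

private
  unipotent-e₁ : ∀ t → mat 1ℤ t 0ℤ 1ℤ ·ᵥ e₁ ≡ e₁
  unipotent-e₁ t = cong₂ _,_ (pick₁ʳ 1ℤ t) (pick₁ʳ 0ℤ 1ℤ)

  det-unipotent : ∀ t → 1ℤ * 1ℤ - t * 0ℤ ≡ 1ℤ
  det-unipotent = solve-∀

≈unipotent : ∀ {n} T → det T ≈ 1ℤ [mod n ] → T ·ᵥ e₁ ≈ᵥ e₁ [mod n ] →
             T ≈ₘ mat 1ℤ (b T) 0ℤ 1ℤ [mod n ]
≈unipotent {n} T@(mat p q r s) det≈1 (vec-≈ p≈1 r≈0) =
  mat-≈ p≈1' ≈-refl r≈0' (begin
    s                 ≡⟨ one-s s q ⟨
    1ℤ * s - q * 0ℤ   ≈⟨ -‿-cong (*-congʳ s (≈-sym p≈1')) (*-congˡ q (≈-sym r≈0')) ⟩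
    p * s - q * r     ≈⟨ det≈1 ⟩
    1ℤ                ∎)
  where
    open ≈-Reasoning n
    p≈1' : p ≈ 1ℤ [mod n ]
    p≈1' = ≈-trans (≈-reflexive (sym (pick₁ʳ p q))) p≈1
    r≈0' : r ≈ 0ℤ [mod n ]
    r≈0' = ≈-trans (≈-reflexive (sym (pick₁ʳ r s))) r≈0
    one-s : ∀ s q → 1ℤ * s - q * 0ℤ ≡ s
    one-s = solve-∀

adj-sends-column-to-e₁ : ∀ γ {x} → det γ ≡ 1ℤ → γ ·ᵥ e₁ ≡ x → adj γ ·ᵥ x ≡ e₁
adj-sends-column-to-e₁ γ {x} det≡1 γe₁≡x = begin
  adj γ ·ᵥ x            ≡⟨ cong (adj γ ·ᵥ_) γe₁≡x ⟨
  adj γ ·ᵥ γ ·ᵥ e₁      ≡⟨ ·-·ᵥ (adj γ) γ e₁ ⟨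
  (adj γ · γ) ·ᵥ e₁     ≡⟨ cong (_·ᵥ e₁) (adj-·-SL₂ γ det≡1) ⟩
  I₂ ·ᵥ e₁              ≡⟨ ·ᵥ-e₁ I₂ ⟩
  e₁                    ∎
  where open ≡-Reasoning

-- γ₀ and γ₁ complete x and y to bases; adj γ₁ · M · γ₀ fixes e₁ mod n, hence is
-- congruent to a unipotent U, and γ₁ · U · adj γ₀ is the required lift.
SL₂-lift : ∀ {n x y} → Primitive x → Primitive y → ∀ M → det M ≈ 1ℤ [mod n ] →
           M ·ᵥ x ≈ᵥ y [mod n ] → ∃ λ γ → det γ ≡ 1ℤ × γ ≈ₘ M [mod n ] × γ ·ᵥ x ≡ y
SL₂-lift {n} {x} {y} x-prim y-prim M det≈1 Mx≈y =
  lift (SL₂-completion x x-prim) (SL₂-completion y y-prim)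
  where
    lift : (∃ λ γ₀ → det γ₀ ≡ 1ℤ × γ₀ ·ᵥ e₁ ≡ x) → (∃ λ γ₁ → det γ₁ ≡ 1ℤ × γ₁ ·ᵥ e₁ ≡ y) →
           ∃ λ γ → det γ ≡ 1ℤ × γ ≈ₘ M [mod n ] × γ ·ᵥ x ≡ y
    lift (γ₀ , det₀ , γ₀e₁≡x) (γ₁ , det₁ , γ₁e₁≡y) = γ , det≡1 , γ≈M , γx≡y
      where
        T = (adj γ₁ · M) · γ₀
        U = mat 1ℤ (b T) 0ℤ 1ℤ
        γ = (γ₁ · U) · adj γ₀

        Te₁≈e₁ : T ·ᵥ e₁ ≈ᵥ e₁ [mod n ]
        Te₁≈e₁ = ≈ᵥ-trans (≈ᵥ-reflexive Te₁≡)
                   (≈ᵥ-trans (·ᵥ-cong (≈ₘ-refl {M = adj γ₁}) Mx≈y)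
                             (≈ᵥ-reflexive (adj-sends-column-to-e₁ γ₁ det₁ γ₁e₁≡y)))
          where
            Te₁≡ : T ·ᵥ e₁ ≡ adj γ₁ ·ᵥ M ·ᵥ x
            Te₁≡ = begin
              T ·ᵥ e₁                        ≡⟨ ·-·ᵥ (adj γ₁ · M) γ₀ e₁ ⟩
              (adj γ₁ · M) ·ᵥ γ₀ ·ᵥ e₁       ≡⟨ cong ((adj γ₁ · M) ·ᵥ_) γ₀e₁≡x ⟩
              (adj γ₁ · M) ·ᵥ x              ≡⟨ ·-·ᵥ (adj γ₁) M x ⟩
              adj γ₁ ·ᵥ M ·ᵥ x               ∎
              where open ≡-Reasoning

        detT≡detM : det T ≡ det M
        detT≡detM = begin
          det T                              ≡⟨ det-· (adj γ₁ · M) γ₀ ⟩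
          det (adj γ₁ · M) * det γ₀          ≡⟨ cong₂ _*_ (det-· (adj γ₁) M) det₀ ⟩
          det (adj γ₁) * det M * 1ℤ          ≡⟨ cong (λ t → t * det M * 1ℤ) (trans (det-adj γ₁) det₁) ⟩
          1ℤ * det M * 1ℤ                    ≡⟨ ℤ.*-identityʳ (1ℤ * det M) ⟩
          1ℤ * det M                         ≡⟨ ℤ.*-identityˡ (det M) ⟩
          det M                              ∎
          where open ≡-Reasoning

        T≈U : T ≈ₘ U [mod n ]
        T≈U = ≈unipotent T (≈-trans (≈-reflexive detT≡detM) det≈1) Te₁≈e₁

        γ₁Tadj₀≡M : (γ₁ · T) · adj γ₀ ≡ M
        γ₁Tadj₀≡M = begin
          (γ₁ · ((adj γ₁ · M) · γ₀)) · adj γ₀   ≡⟨ ·-assoc γ₁ ((adj γ₁ · M) · γ₀) (adj γ₀) ⟩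
          γ₁ · (((adj γ₁ · M) · γ₀) · adj γ₀)   ≡⟨ cong (γ₁ ·_) (·-assoc (adj γ₁ · M) γ₀ (adj γ₀)) ⟩
          γ₁ · ((adj γ₁ · M) · (γ₀ · adj γ₀))   ≡⟨ cong (λ X → γ₁ · ((adj γ₁ · M) · X)) (·-adj-SL₂ γ₀ det₀) ⟩
          γ₁ · ((adj γ₁ · M) · I₂)              ≡⟨ cong (γ₁ ·_) (·-identityʳ (adj γ₁ · M)) ⟩
          γ₁ · (adj γ₁ · M)                     ≡⟨ ·-assoc γ₁ (adj γ₁) M ⟨
          (γ₁ · adj γ₁) · M                     ≡⟨ cong (_· M) (·-adj-SL₂ γ₁ det₁) ⟩
          I₂ · M                                ≡⟨ ·-identityˡ M ⟩
          M                                     ∎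
          where open ≡-Reasoning

        γ≈M : γ ≈ₘ M [mod n ]
        γ≈M = ≈ₘ-trans (·-cong (·-cong (≈ₘ-refl {M = γ₁}) (≈ₘ-sym T≈U)) (≈ₘ-refl {M = adj γ₀}))
                       (≈ₘ-reflexive γ₁Tadj₀≡M)

        det≡1 : det γ ≡ 1ℤ
        det≡1 = begin
          det γ                                 ≡⟨ det-· (γ₁ · U) (adj γ₀) ⟩
          det (γ₁ · U) * det (adj γ₀)           ≡⟨ cong₂ _*_ (det-· γ₁ U) (trans (det-adj γ₀) det₀) ⟩
          det γ₁ * det U * 1ℤ                   ≡⟨ cong₂ (λ s t → s * t * 1ℤ) det₁ (det-unipotent (b T)) ⟩
          1ℤ                                    ∎
          where open ≡-Reasoning

        γx≡y : γ ·ᵥ x ≡ y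
        γx≡y = begin
          γ ·ᵥ x                       ≡⟨ ·-·ᵥ (γ₁ · U) (adj γ₀) x ⟩
          (γ₁ · U) ·ᵥ adj γ₀ ·ᵥ x      ≡⟨ cong ((γ₁ · U) ·ᵥ_) (adj-sends-column-to-e₁ γ₀ det₀ γ₀e₁≡x) ⟩
          (γ₁ · U) ·ᵥ e₁               ≡⟨ ·-·ᵥ γ₁ U e₁ ⟩
          γ₁ ·ᵥ U ·ᵥ e₁                ≡⟨ cong (γ₁ ·ᵥ_) (unipotent-e₁ (b T)) ⟩
          γ₁ ·ᵥ e₁                     ≡⟨ γ₁e₁≡y ⟩
          y                            ∎
          where open ≡-Reasoning

-- The norm form of ℤ[α]

infixr 7 _⋆_
_⋆_ : ℤ → ℤ² → ℤ²
k ⋆ (a , c) = k * a , k * c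

-- (a , c) stands for a + cα ∈ ℤ[α]. Multiplication by z and the conjugation α ↦ u - α
-- act through the matrices mulMat and S-mat of Defs, and norm (a , c) = (a + cα)(a + cᾱ).
module _ (u v : ℤ) where

  norm : ℤ² → ℤ
  norm (a , c) = a * a + u * a * c + v * c * c

  mulBy : ℤ² → M2
  mulBy (x , y) = mulMat u v x y

  infixl 7 _∙_
  _∙_ : ℤ² → ℤ² → ℤ²
  z ∙ w = mulBy z ·ᵥ w

  conj : ℤ² → ℤ²
  conj w = S-mat u ·ᵥ w

  det-mulBy : ∀ z → det (mulBy z) ≡ norm z
  det-mulBy (x , y) = identity u v x y
    where
      identity : ∀ u v x y → x * (x + y * u) - - (y * v) * y ≡ x * x + u * x * y + v * y * y
      identity = solve-∀

  det-S : det (S-mat u) ≡ -1ℤ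
  det-S = identity u
    where
      identity : ∀ u → 1ℤ * - 1ℤ - u * 0ℤ ≡ - 1ℤ
      identity = solve-∀

  det-mulBy·S : ∀ z → det (mulBy z · S-mat u) ≡ - norm z
  det-mulBy·S z = begin
    det (mulBy z · S-mat u)          ≡⟨ det-· (mulBy z) (S-mat u) ⟩
    det (mulBy z) * det (S-mat u)    ≡⟨ cong₂ _*_ (det-mulBy z) det-S ⟩
    norm z * -1ℤ                     ≡⟨ ℤ.*-comm (norm z) -1ℤ ⟩
    -1ℤ * norm z                     ≡⟨ ℤ.-1*i≡-i (norm z) ⟩
    - norm z                         ∎
    where open ≡-Reasoning

  norm-∙ : ∀ z w → norm (z ∙ w) ≡ norm z * norm w
  norm-∙ (x , y) (a , c) = identity u v x y a c
    where
      identity : ∀ u v x y a c → let p = x * a + - (y * v) * c ; q = y * a + (x + y * u) * c in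
        p * p + u * p * q + v * q * q ≡ (x * x + u * x * y + v * y * y) * (a * a + u * a * c + v * c * c)
      identity = solve-∀

  norm-conj : ∀ w → norm (conj w) ≡ norm w
  norm-conj (a , c) = identity u v a c
    where
      identity : ∀ u v a c → let p = 1ℤ * a + u * c ; q = 0ℤ * a + - 1ℤ * c in
        p * p + u * p * q + v * q * q ≡ a * a + u * a * c + v * c * c
      identity = solve-∀

  norm-⋆ : ∀ k w → norm (k ⋆ w) ≡ k * k * norm w
  norm-⋆ k (a , c) = identity u v k a c
    where
      identity : ∀ u v k a c →
        k * a * (k * a) + u * (k * a) * (k * c) + v * (k * c) * (k * c) ≡ k * k * (a * a + u * a * c + v * c * c)
      identity = solve-∀

  norm-neg : ∀ a c → norm (- a , - c) ≡ norm (a , c)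
  norm-neg a c = identity u v a c
    where
      identity : ∀ u v a c → - a * - a + u * - a * - c + v * - c * - c ≡ a * a + u * a * c + v * c * c
      identity = solve-∀

  mulBy-· : ∀ z w → mulBy z · mulBy w ≡ mulBy (z ∙ w)
  mulBy-· (x , y) (x' , y') = mat-cong refl (entry-b u v x y x' y') refl (entry-d u v x y x' y')
    where
      entry-b : ∀ u v x y x' y' → x * - (y' * v) + - (y * v) * (x' + y' * u) ≡ - ((y * x' + (x + y * u) * y') * v)
      entry-b = solve-∀
      entry-d : ∀ u v x y x' y' →
        y * - (y' * v) + (x + y * u) * (x' + y' * u) ≡ x * x' + - (y * v) * y' + (y * x' + (x + y * u) * y') * u
      entry-d = solve-∀

  S-·-mulBy : ∀ z → S-mat u · mulBy z ≡ mulBy (conj z) · S-mat u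
  S-·-mulBy (x , y) = mat-cong (entry-a u v x y) (entry-b u v x y) (entry-c u v x y) (entry-d u v x y)
    where
      entry-a : ∀ u v x y → 1ℤ * x + u * y ≡ (1ℤ * x + u * y) * 1ℤ + - ((0ℤ * x + - 1ℤ * y) * v) * 0ℤ
      entry-a = solve-∀
      entry-b : ∀ u v x y →
        1ℤ * - (y * v) + u * (x + y * u) ≡ (1ℤ * x + u * y) * u + - ((0ℤ * x + - 1ℤ * y) * v) * - 1ℤ
      entry-b = solve-∀
      entry-c : ∀ u v x y →
        0ℤ * x + - 1ℤ * y ≡ (0ℤ * x + - 1ℤ * y) * 1ℤ + (1ℤ * x + u * y + (0ℤ * x + - 1ℤ * y) * u) * 0ℤ
      entry-c = solve-∀
      entry-d : ∀ u v x y →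
        0ℤ * - (y * v) + - 1ℤ * (x + y * u) ≡
        (0ℤ * x + - 1ℤ * y) * u + (1ℤ * x + u * y + (0ℤ * x + - 1ℤ * y) * u) * - 1ℤ
      entry-d = solve-∀

  S-·-S : S-mat u · S-mat u ≡ I₂
  S-·-S = mat-cong (entry-a u) (entry-b u) (entry-c u) (entry-d u)
    where
      entry-a : ∀ u → 1ℤ * 1ℤ + u * 0ℤ ≡ 1ℤ
      entry-a = solve-∀
      entry-b : ∀ u → 1ℤ * u + u * - 1ℤ ≡ 0ℤ
      entry-b = solve-∀
      entry-c : ∀ u → 0ℤ * 1ℤ + - 1ℤ * 0ℤ ≡ 0ℤ
      entry-c = solve-∀
      entry-d : ∀ u → 0ℤ * u + - 1ℤ * - 1ℤ ≡ 1ℤ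
      entry-d = solve-∀

  mulBy-scalar≈I₂ : ∀ {n k} → k ≈ 1ℤ [mod n ] → mulBy (k , 0ℤ) ≈ₘ I₂ [mod n ]
  mulBy-scalar≈I₂ {n} {k} k≈1 =
    mat-≈ k≈1 ≈-refl ≈-refl (≈-trans (≈-reflexive (ℤ.+-identityʳ k)) k≈1)

  norm-cong : ∀ {n w w'} → w ≈ᵥ w' [mod n ] → norm w ≈ norm w' [mod n ]
  norm-cong (vec-≈ a≈a' c≈c') =
    +-cong (+-cong (*-cong a≈a' a≈a') (*-cong (*-congˡ u a≈a') c≈c')) (*-cong (*-congˡ v c≈c') c≈c')

  norm-≈0 : ∀ {n a c} → a ≈ 0ℤ [mod n ] → c ≈ 0ℤ [mod n ] → norm (a , c) ≈ 0ℤ [mod n ]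
  norm-≈0 a≈0 c≈0 = ≈-trans (norm-cong (vec-≈ a≈0 c≈0)) (≈-reflexive (vanish u v))
    where
      vanish : ∀ u v → 0ℤ * 0ℤ + u * 0ℤ * 0ℤ + v * 0ℤ * 0ℤ ≡ 0ℤ
      vanish = solve-∀

  mulBy-·-mulBy·S : ∀ z w → mulBy z · (mulBy w · S-mat u) ≡ mulBy (z ∙ w) · S-mat u
  mulBy-·-mulBy·S z w = trans (sym (·-assoc (mulBy z) (mulBy w) (S-mat u))) (cong (_· (S-mat u)) (mulBy-· z w))

  mulBy·S-·-mulBy : ∀ z w → (mulBy z · S-mat u) · mulBy w ≡ mulBy (z ∙ conj w) · S-mat u
  mulBy·S-·-mulBy z w = begin
    (mulBy z · S-mat u) · mulBy w          ≡⟨ ·-assoc (mulBy z) (S-mat u) (mulBy w) ⟩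
    mulBy z · (S-mat u · mulBy w)          ≡⟨ cong (mulBy z ·_) (S-·-mulBy w) ⟩
    mulBy z · (mulBy (conj w) · S-mat u)   ≡⟨ mulBy-·-mulBy·S z (conj w) ⟩
    mulBy (z ∙ conj w) · S-mat u           ∎
    where open ≡-Reasoning

  mulBy·S-·-mulBy·S : ∀ z w → (mulBy z · S-mat u) · (mulBy w · S-mat u) ≡ mulBy (z ∙ conj w)
  mulBy·S-·-mulBy·S z w = begin
    (mulBy z · S-mat u) · (mulBy w · S-mat u)    ≡⟨ ·-assoc (mulBy z · S-mat u) (mulBy w) (S-mat u) ⟨
    ((mulBy z · S-mat u) · mulBy w) · S-mat u    ≡⟨ cong (_· (S-mat u)) (mulBy·S-·-mulBy z w) ⟩
    (mulBy (z ∙ conj w) · S-mat u) · S-mat u     ≡⟨ ·-assoc (mulBy (z ∙ conj w)) (S-mat u) (S-mat u) ⟩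
    mulBy (z ∙ conj w) · (S-mat u · S-mat u)     ≡⟨ cong (mulBy (z ∙ conj w) ·_) S-·-S ⟩
    mulBy (z ∙ conj w) · I₂                      ≡⟨ ·-identityʳ (mulBy (z ∙ conj w)) ⟩
    mulBy (z ∙ conj w)                           ∎
    where open ≡-Reasoning

  ∙-⋆-conj : ∀ k z → z ∙ (k ⋆ conj z) ≡ (norm z * k , 0ℤ)
  ∙-⋆-conj k (x , y) = cong₂ _,_ (fst u v k x y) (snd u v k x y)
    where
      fst : ∀ u v k x y → let p = 1ℤ * x + u * y ; q = 0ℤ * x + - 1ℤ * y in
        x * (k * p) + - (y * v) * (k * q) ≡ (x * x + u * x * y + v * y * y) * k
      fst = solve-∀
      snd : ∀ u v k x y → let p = 1ℤ * x + u * y ; q = 0ℤ * x + - 1ℤ * y in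
        y * (k * p) + (x + y * u) * (k * q) ≡ 0ℤ
      snd = solve-∀

  ∙-conj-⋆ : ∀ k z → z ∙ conj (k ⋆ z) ≡ (norm z * k , 0ℤ)
  ∙-conj-⋆ k (x , y) = cong₂ _,_ (fst u v k x y) (snd u v k x y)
    where
      fst : ∀ u v k x y → let p = 1ℤ * (k * x) + u * (k * y) ; q = 0ℤ * (k * x) + - 1ℤ * (k * y) in
        x * p + - (y * v) * q ≡ (x * x + u * x * y + v * y * y) * k
      fst = solve-∀
      snd : ∀ u v k x y → let p = 1ℤ * (k * x) + u * (k * y) ; q = 0ℤ * (k * x) + - 1ℤ * (k * y) in
        y * p + (x + y * u) * q ≡ 0ℤ
      snd = solve-∀

  ⋆-∙-conj-∙ : ∀ k x y → (k ⋆ (y ∙ conj x)) ∙ x ≡ (k * norm x) ⋆ y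
  ⋆-∙-conj-∙ k (a , c) (a' , c') = cong₂ _,_ (fst u v k a c a' c') (snd u v k a c a' c')
    where
      fst : ∀ u v k a c a' c' →
        let P = 1ℤ * a + u * c ; Q = 0ℤ * a + - 1ℤ * c
            R = k * (a' * P + - (c' * v) * Q) ; T = k * (c' * P + (a' + c' * u) * Q) in
        R * a + - (T * v) * c ≡ k * (a * a + u * a * c + v * c * c) * a'
      fst = solve-∀
      snd : ∀ u v k a c a' c' →
        let P = 1ℤ * a + u * c ; Q = 0ℤ * a + - 1ℤ * c
            R = k * (a' * P + - (c' * v) * Q) ; T = k * (c' * P + (a' + c' * u) * Q) in
        T * a + (R + T * u) * c ≡ k * (a * a + u * a * c + v * c * c) * c'
      snd = solve-∀

  ⋆-∙-∙-conj : ∀ k x y → (k ⋆ (y ∙ x)) ∙ conj x ≡ (k * norm x) ⋆ y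
  ⋆-∙-∙-conj k (a , c) (a' , c') = cong₂ _,_ (fst u v k a c a' c') (snd u v k a c a' c')
    where
      fst : ∀ u v k a c a' c' →
        let P = 1ℤ * a + u * c ; Q = 0ℤ * a + - 1ℤ * c
            R = k * (a' * a + - (c' * v) * c) ; T = k * (c' * a + (a' + c' * u) * c) in
        R * P + - (T * v) * Q ≡ k * (a * a + u * a * c + v * c * c) * a'
      fst = solve-∀
      snd : ∀ u v k a c a' c' →
        let P = 1ℤ * a + u * c ; Q = 0ℤ * a + - 1ℤ * c
            R = k * (a' * a + - (c' * v) * c) ; T = k * (c' * a + (a' + c' * u) * c) in
        T * P + (R + T * u) * Q ≡ k * (a * a + u * a * c + v * c * c) * c'
      snd = solve-∀

-- If p ∤ c, then -a/c would be a root of X² - uX + v modulo p.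
inert⇒norm-divisor : ∀ {u v p} → Prime p → Inert u v p → ∀ a c →
                     + p ∣ℤ norm u v (a , c) → + p ∣ℤ a × + p ∣ℤ c
inert⇒norm-divisor {u} {v} {p} p-prime inert a c p∣N with + p ℤ∣.∣? c
... | yes p∣c = p∣a , p∣c
  where
    a²≡ : a * a ≡ norm u v (a , c) - (u * a + v * c) * c
    a²≡ = identity u v a c
      where
        identity : ∀ u v a c → a * a ≡ (a * a + u * a * c + v * c * c) - (u * a + v * c) * c
        identity = solve-∀
    p∣a : + p ∣ℤ a
    p∣a = reduce (euclidsLemmaℤ a a p-prime
            (subst (+ p ∣ℤ_) (sym a²≡) (ℤ∣.∣m∣n⇒∣m-n p∣N (ℤ∣.∣n⇒∣m*n (u * a + v * c) p∣c))))
... | no p∤c = ⊥-elim (root (prime∤⇒invertible c p-prime p∤c))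
  where
    root : InvertibleMod p c → ⊥
    root (invertible c⁻¹ cc⁻¹≈1) = inert (r , u - r , ≈⇒≡[mod] (≈-reflexive (sum u r)) , ≈⇒≡[mod] r[u-r]≈v)
      where
        open ≈-Reasoning p
        r = - (a * c⁻¹)
        sum : ∀ u r → r + (u - r) ≡ u
        sum = solve-∀
        expand : ∀ u v a c i → let r = - (a * i) in
          r * (u - r) ≡ v + - (i * i) * (a * a + u * a * c + v * c * c) + u * a * i * (c * i - 1ℤ)
                          + v * (c * i * (c * i) - 1ℤ)
        expand = solve-∀
        vanish : ∀ v x y → v + x * 0ℤ + y * 0ℤ + v * 0ℤ ≡ v
        vanish = solve-∀
        r[u-r]≈v : r * (u - r) ≈ v [mod p ]
        r[u-r]≈v = begin
          r * (u - r)
            ≡⟨ expand u v a c c⁻¹ ⟩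
          v + - (c⁻¹ * c⁻¹) * norm u v (a , c) + u * a * c⁻¹ * (c * c⁻¹ - 1ℤ) + v * (c * c⁻¹ * (c * c⁻¹) - 1ℤ)
            ≈⟨ +-cong (+-cong (+-cong (≈-refl {x = v}) (*-congˡ (- (c⁻¹ * c⁻¹)) (∣⇒≈0 p∣N)))
                              (*-congˡ (u * a * c⁻¹) (≈⇒diff≈0 cc⁻¹≈1)))
                      (*-congˡ v (≈⇒diff≈0 (*-cong cc⁻¹≈1 cc⁻¹≈1))) ⟩
          v + - (c⁻¹ * c⁻¹) * 0ℤ + u * a * c⁻¹ * 0ℤ + v * 0ℤ
            ≡⟨ vanish v (- (c⁻¹ * c⁻¹)) (u * a * c⁻¹) ⟩
          v ∎

primitive⇒norm-invertible : ∀ {u v N} → Admissible u v N → ∀ w → Primitive w → InvertibleMod N (norm u v w)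
primitive⇒norm-invertible {u} {v} {N} adm (a , c) a⊥c =
  gcd≡1⇒invertible (norm u v (a , c)) (noCommonPrime⇒gcd≡1 ∣ norm u v (a , c) ∣ N no-common-prime)
  where
    no-common-prime : ∀ p → Prime p → p ∣ ∣ norm u v (a , c) ∣ → p ∣ N → ⊥
    no-common-prime p p-prime p∣norm p∣N
      with inert⇒norm-divisor p-prime (Admissible.allInert adm p p-prime p∣N) a c
             (ℤ∣.∣ᵤ⇒∣ {+ p} {norm u v (a , c)} p∣norm)
    ... | p∣a , p∣c = prime≢1 p-prime (∣1⇒≡1 (subst (p ∣_) a⊥c (gcd-greatest (ℤ∣.∣⇒∣ᵤ p∣a) (ℤ∣.∣⇒∣ᵤ p∣c))))

-- The normaliser C_ns⁺(N) and the cusps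

leftInverse-unique : ∀ {n} M {M' G} → M' · M ≈ₘ I₂ [mod n ] → M · G ≈ₘ I₂ [mod n ] → M' ≈ₘ G [mod n ]
leftInverse-unique {n} M {M'} {G} M'M≈I MG≈I = begin
  M'             ≡⟨ ·-identityʳ M' ⟨
  M' · I₂        ≈⟨ ·-cong (≈ₘ-refl {M = M'}) (≈ₘ-sym MG≈I) ⟩
  M' · (M · G)   ≡⟨ ·-assoc M' M G ⟨
  (M' · M) · G   ≈⟨ ·-cong M'M≈I (≈ₘ-refl {M = G}) ⟩
  I₂ · G         ≡⟨ ·-identityˡ G ⟩
  G              ∎
  where open ≈ₘ-Reasoning n

det-leftInverse : ∀ {n} M M' → M' · M ≈ₘ I₂ [mod n ] → det M' * det M ≈ 1ℤ [mod n ]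
det-leftInverse {n} M M' M'M≈I = ≈-trans (≈-reflexive (sym (det-· M' M))) (det-cong M'M≈I)

module _ (u v : ℤ) {N : ℕ} where

  mulBy-rightInverse : ∀ z → (inv : InvertibleMod N (norm u v z)) →
                       mulBy u v z · mulBy u v (inverse inv ⋆ conj u v z) ≈ₘ I₂ [mod N ]
  mulBy-rightInverse z (invertible k zk≈1) =
    ≈ₘ-trans (≈ₘ-reflexive (trans (mulBy-· u v z (k ⋆ conj u v z)) (cong (mulBy u v) (∙-⋆-conj u v k z))))
             (mulBy-scalar≈I₂ u v zk≈1)

  mulBy·S-rightInverse : ∀ z → (inv : InvertibleMod N (norm u v z)) →
                         (mulBy u v z · S-mat u) · (mulBy u v (inverse inv ⋆ z) · S-mat u) ≈ₘ I₂ [mod N ]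
  mulBy·S-rightInverse z (invertible k zk≈1) =
    ≈ₘ-trans (≈ₘ-reflexive (trans (mulBy·S-·-mulBy·S u v z (k ⋆ z)) (cong (mulBy u v) (∙-conj-⋆ u v k z))))
             (mulBy-scalar≈I₂ u v zk≈1)

  invertibleNorm⇒isUnit : ∀ {x y} → InvertibleMod N (norm u v (x , y)) → IsUnitA u v N x y
  invertibleNorm⇒isUnit {x} {y} inv =
    proj₁ z⁻¹ , proj₂ z⁻¹ , ≈ₘ⇒≡ₘ (mulBy-rightInverse (x , y) inv)
    where z⁻¹ = inverse inv ⋆ conj u v (x , y)

  cartan-scales-norm : ∀ {γ} z → γ ≈ₘ mulBy u v z [mod N ] →
                       ∀ w → norm u v (γ ·ᵥ w) ≈ det γ * norm u v w [mod N ]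
  cartan-scales-norm {γ} z γ≈ w = begin
    norm u v (γ ·ᵥ w)                  ≈⟨ norm-cong u v (·ᵥ-cong γ≈ (≈ᵥ-reflexive refl)) ⟩
    norm u v (mulBy u v z ·ᵥ w)        ≡⟨ norm-∙ u v z w ⟩
    norm u v z * norm u v w            ≡⟨ cong (_* norm u v w) (det-mulBy u v z) ⟨
    det (mulBy u v z) * norm u v w     ≈⟨ *-congʳ (norm u v w) (det-cong (≈ₘ-sym γ≈)) ⟩
    det γ * norm u v w                 ∎
    where open ≈-Reasoning N

  cartan·S-scales-norm : ∀ {γ} z → γ ≈ₘ mulBy u v z · S-mat u [mod N ] →
                         ∀ w → norm u v (γ ·ᵥ w) ≈ - (det γ * norm u v w) [mod N ]
  cartan·S-scales-norm {γ} z γ≈ w = begin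
    norm u v (γ ·ᵥ w)                             ≈⟨ norm-cong u v (·ᵥ-cong γ≈ (≈ᵥ-reflexive refl)) ⟩
    norm u v ((mulBy u v z · S-mat u) ·ᵥ w)       ≡⟨ cong (norm u v) (·-·ᵥ (mulBy u v z) (S-mat u) w) ⟩
    norm u v (mulBy u v z ·ᵥ conj u v w)          ≡⟨ norm-∙ u v z (conj u v w) ⟩
    norm u v z * norm u v (conj u v w)            ≡⟨ cong (norm u v z *_) (norm-conj u v w) ⟩
    norm u v z * norm u v w                       ≡⟨ flip-sign (norm u v z) (norm u v w) ⟩
    - (- norm u v z * norm u v w)                 ≡⟨ cong (λ t → - (t * norm u v w)) (det-mulBy·S u v z) ⟨
    - (det (mulBy u v z · S-mat u) * norm u v w)  ≈⟨ -‿cong (*-congʳ (norm u v w) (det-cong (≈ₘ-sym γ≈))) ⟩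
    - (det γ * norm u v w)                        ∎
    where
      open ≈-Reasoning N
      flip-sign : ∀ a b → a * b ≡ - (- a * b)
      flip-sign = solve-∀

-- Normal form of the elements of C_ns⁺(N), which Defs generates inductively: z or z · S_N with z ∈ A.
data Cns⁺Form (u v : ℤ) (N : ℕ) (γ : M2) : Set where
  cartan   : ∀ z → γ ≈ₘ mulBy u v z [mod N ] → Cns⁺Form u v N γ
  cartan·S : ∀ z → γ ≈ₘ mulBy u v z · S-mat u [mod N ] → Cns⁺Form u v N γ

module _ {u v : ℤ} {N : ℕ} where

  form-resp-≈ₘ : ∀ {γ γ'} → Cns⁺Form u v N γ → γ ≈ₘ γ' [mod N ] → Cns⁺Form u v N γ'
  form-resp-≈ₘ (cartan z γ≈)   γ≈γ' = cartan z (≈ₘ-trans (≈ₘ-sym γ≈γ') γ≈)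
  form-resp-≈ₘ (cartan·S z γ≈) γ≈γ' = cartan·S z (≈ₘ-trans (≈ₘ-sym γ≈γ') γ≈)

  form-· : ∀ {A B} → Cns⁺Form u v N A → Cns⁺Form u v N B → Cns⁺Form u v N (A · B)
  form-· (cartan z A≈) (cartan w B≈) =
    cartan (_∙_ u v z w) (≈ₘ-trans (·-cong A≈ B≈) (≈ₘ-reflexive (mulBy-· u v z w)))
  form-· (cartan z A≈) (cartan·S w B≈) =
    cartan·S (_∙_ u v z w) (≈ₘ-trans (·-cong A≈ B≈) (≈ₘ-reflexive (mulBy-·-mulBy·S u v z w)))
  form-· (cartan·S z A≈) (cartan w B≈) =
    cartan·S (_∙_ u v z (conj u v w)) (≈ₘ-trans (·-cong A≈ B≈) (≈ₘ-reflexive (mulBy·S-·-mulBy u v z w)))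
  form-· (cartan·S z A≈) (cartan·S w B≈) =
    cartan (_∙_ u v z (conj u v w)) (≈ₘ-trans (·-cong A≈ B≈) (≈ₘ-reflexive (mulBy·S-·-mulBy·S u v z w)))

  form-leftInverse : ∀ {M M'} → Cns⁺Form u v N M → M' · M ≈ₘ I₂ [mod N ] → Cns⁺Form u v N M'
  form-leftInverse {M} {M'} (cartan z M≈) M'M≈I =
    cartan (inverse z⁻¹ ⋆ conj u v z)
           (leftInverse-unique M M'M≈I (≈ₘ-trans (·-cong M≈ ≈ₘ-refl) (mulBy-rightInverse u v z z⁻¹)))
    where
      z⁻¹ : InvertibleMod N (norm u v z)
      z⁻¹ = invertible (det M') (begin
        norm u v z * det M'        ≡⟨ ℤ.*-comm (norm u v z) (det M') ⟩
        det M' * norm u v z        ≡⟨ cong (det M' *_) (det-mulBy u v z) ⟨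
        det M' * det (mulBy u v z) ≈⟨ *-congˡ (det M') (det-cong (≈ₘ-sym M≈)) ⟩
        det M' * det M             ≈⟨ det-leftInverse M M' M'M≈I ⟩
        1ℤ                         ∎)
        where open ≈-Reasoning N
  form-leftInverse {M} {M'} (cartan·S z M≈) M'M≈I =
    cartan·S (inverse z⁻¹ ⋆ z)
             (leftInverse-unique M M'M≈I (≈ₘ-trans (·-cong M≈ ≈ₘ-refl) (mulBy·S-rightInverse u v z z⁻¹)))
    where
      swap-sign : ∀ a b → a * - b ≡ b * - a
      swap-sign = solve-∀
      z⁻¹ : InvertibleMod N (norm u v z)
      z⁻¹ = invertible (- det M') (begin
        norm u v z * - det M'                 ≡⟨ swap-sign (norm u v z) (det M') ⟩
        det M' * - norm u v z                 ≡⟨ cong (det M' *_) (det-mulBy·S u v z) ⟨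
        det M' * det (mulBy u v z · S-mat u)  ≈⟨ *-congˡ (det M') (det-cong (≈ₘ-sym M≈)) ⟩
        det M' * det M                        ≈⟨ det-leftInverse M M' M'M≈I ⟩
        1ℤ                                    ∎)
        where open ≈-Reasoning N

  InCns⁺⇒form : ∀ {γ} → InCns⁺ u v N γ → Cns⁺Form u v N γ
  InCns⁺⇒form (gen-C (x , y , _ , γ≡)) = cartan (x , y) (≡ₘ⇒≈ₘ γ≡)
  InCns⁺⇒form (gen-S γ≡S)              =
    cartan·S e₁ (≈ₘ-trans (≡ₘ⇒≈ₘ γ≡S) (≈ₘ-reflexive (sym (·-identityˡ (S-mat u)))))
  InCns⁺⇒form (gen-mul p q)            = form-· (InCns⁺⇒form p) (InCns⁺⇒form q)
  InCns⁺⇒form (gen-inv p M'M≡I)        = form-leftInverse (InCns⁺⇒form p) (≡ₘ⇒≈ₘ M'M≡I)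
  InCns⁺⇒form (gen-cong p M≡M')        = form-resp-≈ₘ (InCns⁺⇒form p) (≡ₘ⇒≈ₘ M≡M')

  form-scales-norm : ∀ {γ} → Cns⁺Form u v N γ →
    (∀ w → norm u v (γ ·ᵥ w) ≈ det γ * norm u v w [mod N ]) ⊎
    (∀ w → norm u v (γ ·ᵥ w) ≈ - (det γ * norm u v w) [mod N ])
  form-scales-norm (cartan z γ≈)   = inj₁ (cartan-scales-norm u v z γ≈)
  form-scales-norm (cartan·S z γ≈) = inj₂ (cartan·S-scales-norm u v z γ≈)

vec : P1Q → ℤ²
vec x = num x , den x

cuspNorm : ℤ → ℤ → P1Q → ℤ
cuspNorm u v x = norm u v (vec x)

⋆-≈1 : ∀ {n k} w → k ≈ 1ℤ [mod n ] → k ⋆ w ≈ᵥ w [mod n ]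
⋆-≈1 (a , c) k≈1 = vec-≈ (≈-trans (*-congʳ a k≈1) (≈-reflexive (ℤ.*-identityˡ a)))
                         (≈-trans (*-congʳ c k≈1) (≈-reflexive (ℤ.*-identityˡ c)))

sameCusp-viaLift : ∀ {H : M2 → Set} {n} x y M → (∀ {γ} → γ ≈ₘ M [mod n ] → H γ) →
                   det M ≈ 1ℤ [mod n ] → M ·ᵥ vec x ≈ᵥ vec y [mod n ] → SameCusp H x y
sameCusp-viaLift {H} {n} x y M H-resp det≈1 Mx≈y = fromLift (SL₂-lift (prim x) (prim y) M det≈1 Mx≈y)
  where
    fromLift : (∃ λ γ → det γ ≡ 1ℤ × γ ≈ₘ M [mod n ] × γ ·ᵥ vec x ≡ vec y) → SameCusp H x y
    fromLift (γ , det≡1 , γ≈M , γx≡y) = γ , (det≡1 , H-resp γ≈M) , inj₁ (cong proj₁ γx≡y , cong proj₂ γx≡y)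

sameCusp-Cns⇒Cns⁺ : ∀ {u v N x y} → SameCusp (InCns u v N) x y → SameCusp (InCns⁺ u v N) x y
sameCusp-Cns⇒Cns⁺ (γ , (det≡1 , γ∈Cns) , acts) = γ , (det≡1 , gen-C γ∈Cns) , acts

module _ {u v : ℤ} {N : ℕ} where

  private
    𝒩 = norm u v

  actsTo-norm : ∀ γ x y → ActsTo γ x y → 𝒩 (γ ·ᵥ vec x) ≡ cuspNorm u v y
  actsTo-norm γ x y (inj₁ (num≡ , den≡)) = cong 𝒩 (cong₂ _,_ num≡ den≡)
  actsTo-norm γ x y (inj₂ (num≡ , den≡)) = trans (cong 𝒩 (cong₂ _,_ num≡ den≡)) (norm-neg u v (num y) (den y))

  private
    unimodular : ∀ γ {t} → det γ ≡ 1ℤ → det γ * t ≡ t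
    unimodular γ {t} det≡1 = trans (cong (_* t) det≡1) (ℤ.*-identityˡ t)

  sameCusp⇒norm≈ : ∀ {x y} → SameCusp (InCns u v N) x y → cuspNorm u v y ≈ cuspNorm u v x [mod N ]
  sameCusp⇒norm≈ {x} {y} (γ , (det≡1 , (p , q , _ , γ≡)) , acts) = begin
    cuspNorm u v y           ≡⟨ actsTo-norm γ x y acts ⟨
    𝒩 (γ ·ᵥ vec x)           ≈⟨ cartan-scales-norm u v {γ = γ} (p , q) (≡ₘ⇒≈ₘ γ≡) (vec x) ⟩
    det γ * cuspNorm u v x   ≡⟨ unimodular γ det≡1 ⟩
    cuspNorm u v x           ∎
    where open ≈-Reasoning N

  sameCusp⁺⇒norm≈± : ∀ {x y} → SameCusp (InCns⁺ u v N) x y →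
                     cuspNorm u v y ≈ cuspNorm u v x [mod N ] ⊎ cuspNorm u v y ≈ - cuspNorm u v x [mod N ]
  sameCusp⁺⇒norm≈± {x} {y} (γ , (det≡1 , γ∈) , acts) with form-scales-norm (InCns⁺⇒form γ∈)
  ... | inj₁ scales = inj₁ (begin
    cuspNorm u v y              ≡⟨ actsTo-norm γ x y acts ⟨
    𝒩 (γ ·ᵥ vec x)              ≈⟨ scales (vec x) ⟩
    det γ * cuspNorm u v x      ≡⟨ unimodular γ det≡1 ⟩
    cuspNorm u v x              ∎)
    where open ≈-Reasoning N
  ... | inj₂ scales = inj₂ (begin
    cuspNorm u v y              ≡⟨ actsTo-norm γ x y acts ⟨
    𝒩 (γ ·ᵥ vec x)              ≈⟨ scales (vec x) ⟩
    - (det γ * cuspNorm u v x)  ≡⟨ cong -_ (unimodular γ det≡1) ⟩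
    - cuspNorm u v x            ∎)
    where open ≈-Reasoning N

  -- With k the inverse of norm x, the element z = k · y · x̄ of A has norm ≡ 1 and sends x to y.
  norm≈⇒sameCusp : ∀ {x y} → InvertibleMod N (cuspNorm u v x) → cuspNorm u v y ≈ cuspNorm u v x [mod N ] →
                   SameCusp (InCns u v N) x y
  norm≈⇒sameCusp {x} {y} (invertible k xk≈1) y≈x =
    sameCusp-viaLift {H = InCns u v N} x y (mulBy u v z) inCns det≈1 zx≈y
    where
      open ≈-Reasoning N
      X = cuspNorm u v x
      Y = cuspNorm u v y
      z = k ⋆ _∙_ u v (vec y) (conj u v (vec x))

      kX≈1 : k * X ≈ 1ℤ [mod N ]
      kX≈1 = ≈-trans (≈-reflexive (ℤ.*-comm k X)) xk≈1

      z≈1 : 𝒩 z ≈ 1ℤ [mod N ]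
      z≈1 = begin
        𝒩 z                                               ≡⟨ norm-⋆ u v k _ ⟩
        k * k * 𝒩 (_∙_ u v (vec y) (conj u v (vec x)))    ≡⟨ cong (k * k *_) (norm-∙ u v (vec y) _) ⟩
        k * k * (Y * 𝒩 (conj u v (vec x)))                ≡⟨ cong (λ t → k * k * (Y * t)) (norm-conj u v (vec x)) ⟩
        k * k * (Y * X)                                   ≈⟨ *-congˡ (k * k) (*-congʳ X y≈x) ⟩
        k * k * (X * X)                                   ≡⟨ regroup k X ⟩
        (k * X) * (k * X)                                 ≈⟨ *-cong kX≈1 kX≈1 ⟩
        1ℤ                                                ∎
        where
          regroup : ∀ k X → k * k * (X * X) ≡ (k * X) * (k * X)
          regroup = solve-∀

      det≈1 : det (mulBy u v z) ≈ 1ℤ [mod N ]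
      det≈1 = ≈-trans (≈-reflexive (det-mulBy u v z)) z≈1

      zx≈y : mulBy u v z ·ᵥ vec x ≈ᵥ vec y [mod N ]
      zx≈y = ≈ᵥ-trans (≈ᵥ-reflexive (⋆-∙-conj-∙ u v k (vec x) (vec y))) (⋆-≈1 (vec y) kX≈1)

      inCns : ∀ {γ} → γ ≈ₘ mulBy u v z [mod N ] → InCns u v N γ
      inCns γ≈ = proj₁ z , proj₂ z ,
                 invertibleNorm⇒isUnit u v {x = proj₁ z} {y = proj₂ z}
                   (invertible 1ℤ (≈-trans (≈-reflexive (ℤ.*-identityʳ (𝒩 z))) z≈1)) ,
                 ≈ₘ⇒≡ₘ γ≈

  -- Here z = k · y · x has norm ≡ -1, and z composed with the involution S sends x to y.
  norm≈-⇒sameCusp⁺ : ∀ {x y} → InvertibleMod N (cuspNorm u v x) → cuspNorm u v y ≈ - cuspNorm u v x [mod N ] →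
                     SameCusp (InCns⁺ u v N) x y
  norm≈-⇒sameCusp⁺ {x} {y} (invertible k xk≈1) y≈-x =
    sameCusp-viaLift {H = InCns⁺ u v N} x y (mulBy u v z · S-mat u) inCns⁺ det≈1 zx≈y
    where
      open ≈-Reasoning N
      X = cuspNorm u v x
      z = k ⋆ _∙_ u v (vec y) (vec x)

      kX≈1 : k * X ≈ 1ℤ [mod N ]
      kX≈1 = ≈-trans (≈-reflexive (ℤ.*-comm k X)) xk≈1

      z≈-1 : 𝒩 z ≈ - 1ℤ [mod N ]
      z≈-1 = begin
        𝒩 z                                   ≡⟨ norm-⋆ u v k _ ⟩
        k * k * 𝒩 (_∙_ u v (vec y) (vec x))  ≡⟨ cong (k * k *_) (norm-∙ u v (vec y) (vec x)) ⟩
        k * k * (cuspNorm u v y * X)         ≈⟨ *-congˡ (k * k) (*-congʳ X y≈-x) ⟩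
        k * k * (- X * X)                    ≡⟨ regroup k X ⟩
        - ((k * X) * (k * X))                ≈⟨ -‿cong (*-cong kX≈1 kX≈1) ⟩
        - 1ℤ                                 ∎
        where
          regroup : ∀ k X → k * k * (- X * X) ≡ - ((k * X) * (k * X))
          regroup = solve-∀

      det≈1 : det (mulBy u v z · S-mat u) ≈ 1ℤ [mod N ]
      det≈1 = begin
        det (mulBy u v z · S-mat u)   ≡⟨ det-mulBy·S u v z ⟩
        - 𝒩 z                         ≈⟨ -‿cong z≈-1 ⟩
        1ℤ                            ∎

      zx≈y : (mulBy u v z · S-mat u) ·ᵥ vec x ≈ᵥ vec y [mod N ]
      zx≈y = ≈ᵥ-trans (≈ᵥ-reflexive (trans (·-·ᵥ (mulBy u v z) (S-mat u) (vec x)) (⋆-∙-∙-conj u v k (vec x) (vec y))))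
                      (⋆-≈1 (vec y) kX≈1)

      z∈Cns : InCns u v N (mulBy u v z)
      z∈Cns = proj₁ z , proj₂ z ,
              invertibleNorm⇒isUnit u v {x = proj₁ z} {y = proj₂ z} (invertible -1ℤ (*-congʳ -1ℤ z≈-1)) ,
              ≈ₘ⇒≡ₘ (≈ₘ-refl {M = mulBy u v z})

      S∈Cns⁺ : InCns⁺ u v N (S-mat u)
      S∈Cns⁺ = gen-S (≈ₘ⇒≡ₘ (≈ₘ-refl {M = S-mat u}))

      inCns⁺ : ∀ {γ} → γ ≈ₘ mulBy u v z · S-mat u [mod N ] → InCns⁺ u v N γ
      inCns⁺ γ≈ = gen-cong (gen-mul (gen-C {M = mulBy u v z} z∈Cns) S∈Cns⁺) (≈ₘ⇒≡ₘ (≈ₘ-sym γ≈))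

-- Every unit is the norm of a primitive vector

coprimePart : ∀ c m .{{_ : NonZero m}} → ∃ λ r → gcd r c ≡ 1 × (∀ p → Prime p → p ∣ m → ¬ p ∣ c → p ∣ r)
coprimePart c m = product qs , r⊥c , covers
  where
    fm = factorise m
    ps = PrimeFactorisation.factors fm
    qs = filter (λ p → ¬? (p ∣? c)) ps
    r⊥c : gcd (product qs) c ≡ 1
    r⊥c = noCommonPrime⇒gcd≡1 (product qs) c λ p p-prime p∣r p∣c →
      proj₂ (∈-filter⁻ (λ p → ¬? (p ∣? c)) {xs = ps} (factorisationHasAllPrimeFactors p-prime p∣r
               (All.filter⁺ (λ p → ¬? (p ∣? c)) (PrimeFactorisation.factorsPrime fm)))) p∣c
    covers : ∀ p → Prime p → p ∣ m → ¬ p ∣ c → p ∣ product qs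
    covers p p-prime p∣m p∤c = ∈⇒∣product (∈-filter⁺ (λ p → ¬? (p ∣? c))
      (factorisationHasAllPrimeFactors p-prime (subst (p ∣_) (PrimeFactorisation.isFactorisation fm) p∣m)
                                        (PrimeFactorisation.factorsPrime fm)) p∤c)

private
  nonzero-representative : ∀ {n} → 0 < n → ∀ a → ∃ λ a₀ → a₀ ≈ a [mod n ] × NonZero ∣ a₀ ∣
  nonzero-representative {n} 0<n a with ∣ a ∣ ℕ.≟ 0
  ... | no ∣a∣≢0 = a , ≈-refl , ℕ.≢-nonZero ∣a∣≢0
  ... | yes ∣a∣≡0 = + n , n≈a , ℕ.>-nonZero 0<n
    where
      n≈a : + n ≈ a [mod n ]
      n≈a = ≈-trans (≈-reflexive (sym (ℤ.*-identityˡ (+ n))))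
                    (≈-trans (multiple≈0 1ℤ) (≈-reflexive (sym (ℤ.∣i∣≡0⇒i≡0 ∣a∣≡0))))

-- Keep a ≠ 0 and add to c the multiple r · n of n, where r collects the prime factors of a
-- that do not divide c.
primitive-lift : ∀ {n} → 0 < n → ∀ a c → (∀ p → Prime p → p ∣ n → + p ∣ℤ a → + p ∣ℤ c → ⊥) →
                 ∃ λ w → Primitive w × w ≈ᵥ (a , c) [mod n ]
primitive-lift {n} 0<n a c no-common-prime = lift (nonzero-representative 0<n a)
  where
    lift : (∃ λ a₀ → a₀ ≈ a [mod n ] × NonZero ∣ a₀ ∣) → ∃ λ w → Primitive w × w ≈ᵥ (a , c) [mod n ]
    lift (a₀ , a₀≈a , a₀≢0) = (a₀ , c') , coprime , vec-≈ a₀≈a c'≈c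
      where
        r-spec = coprimePart ∣ c ∣ ∣ a₀ ∣ {{a₀≢0}}
        r = proj₁ r-spec
        c' = c + + r * + n

        c'≈c : c' ≈ c [mod n ]
        c'≈c = ≈-trans (+-cong (≈-refl {x = c}) (multiple≈0 (+ r))) (≈-reflexive (ℤ.+-identityʳ c))

        c'-c≡rn : c' - c ≡ + r * + n
        c'-c≡rn = cancel c (+ r * + n)
          where
            cancel : ∀ c m → c + m - c ≡ m
            cancel = solve-∀

        c'-rn≡c : c' - + r * + n ≡ c
        c'-rn≡c = cancel c (+ r * + n)
          where
            cancel : ∀ c m → c + m - m ≡ c
            cancel = solve-∀

        common-prime-absurd : ∀ p → Prime p → p ∣ ∣ a₀ ∣ → p ∣ ∣ c' ∣ → ⊥
        common-prime-absurd p p-prime p∣a₀ p∣c' with p ∣? ∣ c ∣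
        ... | no p∤c = p∤c (ℤ∣.∣⇒∣ᵤ (subst (+ p ∣ℤ_) c'-rn≡c
                (ℤ∣.∣m∣n⇒∣m-n (ℤ∣.∣ᵤ⇒∣ {+ p} {c'} p∣c') (ℤ∣.∣m⇒∣m*n (+ n) (ℤ∣.∣ᵤ⇒∣ {+ p} {+ r} p∣r)))))
          where
            p∣r : p ∣ r
            p∣r = proj₂ (proj₂ r-spec) p p-prime p∣a₀ p∤c
        ... | yes p∣c with euclidsLemmaℤ (+ r) (+ n) p-prime
                             (subst (+ p ∣ℤ_) c'-c≡rn (ℤ∣.∣m∣n⇒∣m-n (ℤ∣.∣ᵤ⇒∣ {+ p} {c'} p∣c') (ℤ∣.∣ᵤ⇒∣ {+ p} {c} p∣c)))
        ...   | inj₁ p∣r = prime≢1 p-prime (∣1⇒≡1 (subst (p ∣_) (proj₁ (proj₂ r-spec))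
                             (gcd-greatest (ℤ∣.∣⇒∣ᵤ p∣r) p∣c)))
        ...   | inj₂ p∣n = no-common-prime p p-prime (ℤ∣.∣⇒∣ᵤ p∣n)
                  (≈0⇒∣ (≈-trans (≈-mod-∣ (ℤ∣.∣⇒∣ᵤ p∣n) (≈-sym a₀≈a)) (∣⇒≈0 (ℤ∣.∣ᵤ⇒∣ {+ p} {a₀} p∣a₀))))
                  (ℤ∣.∣ᵤ⇒∣ {+ p} {c} p∣c)

        coprime : gcd ∣ a₀ ∣ ∣ c' ∣ ≡ 1
        coprime = noCommonPrime⇒gcd≡1 ∣ a₀ ∣ ∣ c' ∣ common-prime-absurd

Represented : ℤ → ℤ → ℤ → ℕ → Set
Represented u v K m = ∃ λ w → norm u v w ≈ K [mod m ]

represented-mod2 : ∀ u v K → Represented u v K 2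
represented-mod2 u v K = (K , 0ℤ) , (begin
  norm u v (K , 0ℤ)      ≈⟨ norm-cong u v (vec-≈ (≈-%ℕ K) ≈-refl) ⟩
  norm u v (+ r , 0ℤ)    ≡⟨ norm-x0 u v (+ r) ⟩
  + r * + r              ≡⟨ idempotent (n%ℕd<d K 2) ⟩
  + r                    ≈⟨ ≈-sym (≈-%ℕ K) ⟩
  K                      ∎)
  where
    open ≈-Reasoning 2
    r = K %ℕ 2
    norm-x0 : ∀ u v x → x * x + u * x * 0ℤ + v * 0ℤ * 0ℤ ≡ x * x
    norm-x0 = solve-∀
    idempotent : ∀ {r} → r < 2 → + r * + r ≡ + r
    idempotent {0} _ = refl
    idempotent {1} _ = refl
    idempotent {suc (suc _)} (s≤s (s≤s ()))

module OddPrime (h : ℕ) (p-prime : Prime (suc (h ℕ.+ h))) where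

  private
    p = suc (h ℕ.+ h)

    ≤h⇒<p : ∀ {a} → a ≤ h → a < p
    ≤h⇒<p a≤h = s≤s (ℕ.≤-trans a≤h (ℕ.m≤m+n h h))

  squares-injective : ∀ {a b} → a ≤ h → b ≤ h → + a * + a ≈ + b * + b [mod p ] → a ≡ b
  squares-injective {a} {b} a≤h b≤h a²≈b²
    with euclidsLemmaℤ (+ a - + b) (+ a + + b) p-prime
           (subst (+ p ∣ℤ_) (difference-of-squares (+ a) (+ b)) (divides-diff a²≈b²))
    where
      difference-of-squares : ∀ a b → a * a - b * b ≡ (a - b) * (a + b)
      difference-of-squares = solve-∀
  ... | inj₁ p∣a-b = small-≈⇒≡ (≤h⇒<p a≤h) (≤h⇒<p b≤h) (congruent p∣a-b)
  ... | inj₂ p∣a+b = trans (ℕ.m+n≡0⇒m≡0 a a+b≡0) (sym (ℕ.m+n≡0⇒n≡0 a a+b≡0))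
    where
      a+b≡0 : a ℕ.+ b ≡ 0
      a+b≡0 = small-≈⇒≡ (s≤s (ℕ.+-mono-≤ a≤h b≤h)) (s≤s z≤n)
                (≈-trans (≈-reflexive (ℤ.pos-+ a b)) (∣⇒≈0 p∣a+b))

  two-inverse : + 2 * + suc h ≈ 1ℤ [mod p ]
  two-inverse = congruent (ℤ∣.divides 1ℤ (begin
    + 2 * + suc h - 1ℤ        ≡⟨ cong (λ t → + 2 * t - 1ℤ) (ℤ.pos-+ 1 h) ⟩
    + 2 * (1ℤ + + h) - 1ℤ     ≡⟨ double (+ h) ⟩
    1ℤ * (1ℤ + (+ h + + h))   ≡⟨ cong (λ t → 1ℤ * (1ℤ + t)) (ℤ.pos-+ h h) ⟨
    1ℤ * (1ℤ + + (h ℕ.+ h))   ≡⟨ cong (1ℤ *_) (ℤ.pos-+ 1 (h ℕ.+ h)) ⟨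
    1ℤ * + p                  ∎))
    where
      open ≡-Reasoning
      double : ∀ h → + 2 * (1ℤ + h) - 1ℤ ≡ 1ℤ * (1ℤ + (h + h))
      double = solve-∀

  module _ (u v K : ℤ) (p∤D : ¬ (+ p ∣ℤ disc u v)) where

    private
      D = disc u v
      n = suc h

      sq : ℕ → ℤ
      sq k = + k * + k

      value : Fin n ⊎ Fin n → ℤ
      value = [ sq ∘ toℕ , (λ j → + 4 * K + D * sq (toℕ j)) ]′

      toℕ≤h : (i : Fin n) → toℕ i ≤ h
      toℕ≤h i = ℕ.≤-pred (Fin.toℕ<n i)

      D⁻¹ : InvertibleMod p D
      D⁻¹ = prime∤⇒invertible D p-prime p∤D

    collision : ∀ x y → x ≢ y → value x ≈ value y [mod p ] →
                ∃₂ λ s c → s * s ≈ + 4 * K + D * (c * c) [mod p ]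
    collision (inj₁ a) (inj₁ b) a≢b a²≈b² =
      ⊥-elim (a≢b (cong inj₁ (Fin.toℕ-injective (squares-injective (toℕ≤h a) (toℕ≤h b) a²≈b²))))
    collision (inj₂ a) (inj₂ b) a≢b eq =
      ⊥-elim (a≢b (cong inj₂ (Fin.toℕ-injective (squares-injective (toℕ≤h a) (toℕ≤h b)
        (*-cancelˡ-invertible D⁻¹ (+-cancelˡ (+ 4 * K) eq))))))
    collision (inj₁ a) (inj₂ b) _ eq = + toℕ a , + toℕ b , eq
    collision (inj₂ a) (inj₁ b) _ eq = + toℕ b , + toℕ a , ≈-sym eq

    -- Two of the p + 1 numbers s² and 4K + D c² (0 ≤ s, c ≤ h) agree mod p, and two of
    -- the same kind cannot, as s ↦ s² is injective on 0, …, h and D is a unit.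
    square-collision : ∃₂ λ s c → s * s ≈ + 4 * K + D * (c * c) [mod p ]
    square-collision = fromPigeonhole (Fin.pigeonhole p<n+n residue)
      where
        p<n+n : p < n ℕ.+ n
        p<n+n = s≤s (ℕ.≤-reflexive (sym (ℕ.+-suc h h)))
        residue : Fin (n ℕ.+ n) → Fin p
        residue i = fromℕ< (n%ℕd<d (value (splitAt n i)) p)
        fromPigeonhole : (∃₂ λ i j → i Fin.< j × residue i ≡ residue j) →
                         ∃₂ λ s c → s * s ≈ + 4 * K + D * (c * c) [mod p ]
        fromPigeonhole (i , j , i<j , ri≡rj) =
          collision (splitAt n i) (splitAt n j)
            (λ eq → Fin.<⇒≢ i<j (trans (sym (Fin.join-splitAt n n i))
                                       (trans (cong (join n n) eq) (Fin.join-splitAt n n j))))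
            (%ℕ≡⇒≈ (trans (sym (Fin.toℕ-fromℕ< _)) (trans (cong toℕ ri≡rj) (Fin.toℕ-fromℕ< _))))

    -- 4 · norm (a , c) = (2a + uc)² - D c², and 2 is invertible mod p.
    complete-square : (∃₂ λ s c → s * s ≈ + 4 * K + D * (c * c) [mod p ]) → Represented u v K p
    complete-square (s , c , s²≈) = (a₀ , c) , *-cancelˡ-invertible four⁻¹ (begin
      + 4 * norm u v (a₀ , c)                                 ≡⟨ times-four u v a₀ c ⟩
      (+ 2 * a₀ + u * c) * (+ 2 * a₀ + u * c) - D * (c * c)  ≈⟨ -‿-cong (*-cong 2a+uc≈s 2a+uc≈s) ≈-refl ⟩
      s * s - D * (c * c)                                    ≈⟨ -‿-cong s²≈ ≈-refl ⟩
      + 4 * K + D * (c * c) - D * (c * c)                    ≡⟨ cancel (+ 4 * K) (D * (c * c)) ⟩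
      + 4 * K                                                ∎)
      where
        open ≈-Reasoning p
        a₀ = (s - u * c) * + n
        times-four : ∀ u v a c →
          + 4 * (a * a + u * a * c + v * c * c) ≡ (+ 2 * a + u * c) * (+ 2 * a + u * c) - (u * u - + 4 * v) * (c * c)
        times-four = solve-∀
        cancel : ∀ x y → x + y - y ≡ x
        cancel = solve-∀
        2a+uc≈s : + 2 * a₀ + u * c ≈ s [mod p ]
        2a+uc≈s = begin
          + 2 * ((s - u * c) * + n) + u * c     ≡⟨ regroup (s - u * c) (u * c) (+ n) ⟩
          + 2 * + n * (s - u * c) + u * c       ≈⟨ +-cong (*-congʳ (s - u * c) two-inverse) ≈-refl ⟩
          1ℤ * (s - u * c) + u * c              ≡⟨ cancel' s (u * c) ⟩
          s                                     ∎
          where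
            regroup : ∀ d e n → + 2 * (d * n) + e ≡ + 2 * n * d + e
            regroup = solve-∀
            cancel' : ∀ s e → 1ℤ * (s - e) + e ≡ s
            cancel' = solve-∀
        four⁻¹ : InvertibleMod p (+ 4)
        four⁻¹ = invertible (+ n * + n) (begin
          + 4 * (+ n * + n)            ≡⟨ regroup (+ n) ⟩
          (+ 2 * + n) * (+ 2 * + n)    ≈⟨ *-cong two-inverse two-inverse ⟩
          1ℤ                           ∎)
          where
            regroup : ∀ n → + 4 * (n * n) ≡ (+ 2 * n) * (+ 2 * n)
            regroup = solve-∀

    represented-oddPrime : Represented u v K p
    represented-oddPrime = complete-square square-collision

hensel-step : ∀ {p q} → p ∣ q → ∀ {N₀ K} P C → InvertibleMod p P → N₀ ≈ K [mod q ] →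
              ∃ λ s → N₀ + s * P + s * s * C ≈ K [mod q ℕ.* p ]
hensel-step {p} {q} p∣q {N₀} {K} P C (invertible i Pi≈1) (congruent (ℤ∣.divides e N₀-K≡eq)) =
  t * + q , ≈-mod-* {m = q} {n = p} X expand X≈0
  where
    t = - (e * i)
    X = e * (1ℤ - P * i) + + q * (t * t * C)

    expand : N₀ + t * + q * P + t * + q * (t * + q) * C - K ≡ + q * X
    expand = begin
      N₀ + t * + q * P + t * + q * (t * + q) * C - K   ≡⟨ separate N₀ K t (+ q) P C ⟩
      (N₀ - K) + + q * (t * P + t * t * + q * C)       ≡⟨ cong (λ d → d + + q * (t * P + t * t * + q * C)) N₀-K≡eq ⟩
      e * + q + + q * (t * P + t * t * + q * C)        ≡⟨ collect e i (+ q) P C ⟩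
      + q * X                                          ∎
      where
        open ≡-Reasoning
        separate : ∀ N₀ K t q P C → N₀ + t * q * P + t * q * (t * q) * C - K ≡ (N₀ - K) + q * (t * P + t * t * q * C)
        separate = solve-∀
        collect : ∀ e i q P C → let t = - (e * i) in
          e * q + q * (t * P + t * t * q * C) ≡ q * (e * (1ℤ - P * i) + q * (t * t * C))
        collect = solve-∀

    X≈0 : X ≈ 0ℤ [mod p ]
    X≈0 = begin
      e * (1ℤ - P * i) + + q * (t * t * C)
        ≈⟨ +-cong (*-congˡ e (-‿-cong (≈-refl {x = 1ℤ}) Pi≈1)) (*-congʳ (t * t * C) q≈0) ⟩
      e * (1ℤ - 1ℤ) + 0ℤ * (t * t * C)        ≡⟨ vanish e (t * t * C) ⟩
      0ℤ                                      ∎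
      where
        open ≈-Reasoning p
        q≈0 : + q ≈ 0ℤ [mod p ]
        q≈0 = ∣⇒≈0 (ℤ∣.∣ᵤ⇒∣ p∣q)
        vanish : ∀ e x → e * (1ℤ - 1ℤ) + 0ℤ * x ≡ 0ℤ
        vanish = solve-∀

module _ {u v K : ℤ} where

  private
    ∂₁ ∂₂ : ℤ² → ℤ
    ∂₁ (a , c) = + 2 * a + u * c
    ∂₂ (a , c) = u * a + + 2 * v * c

    shift₁ : ∀ {m} a c → (∃ λ s → norm u v (a , c) + s * ∂₁ (a , c) + s * s * 1ℤ ≈ K [mod m ]) → Represented u v K m
    shift₁ a c (s , e) = (a + s , c) , ≈-trans (≈-reflexive (expand u v a c s)) e
      where
        expand : ∀ u v a c s → (a + s) * (a + s) + u * (a + s) * c + v * c * c ≡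
                 a * a + u * a * c + v * c * c + s * (+ 2 * a + u * c) + s * s * 1ℤ
        expand = solve-∀

    shift₂ : ∀ {m} a c → (∃ λ s → norm u v (a , c) + s * ∂₂ (a , c) + s * s * v ≈ K [mod m ]) → Represented u v K m
    shift₂ a c (s , e) = (a , c + s) , ≈-trans (≈-reflexive (expand u v a c s)) e
      where
        expand : ∀ u v a c s → a * a + u * a * (c + s) + v * (c + s) * (c + s) ≡
                 a * a + u * a * c + v * c * c + s * (u * a + + 2 * v * c) + s * s * v
        expand = solve-∀

  -- Newton's method: if p divided both partial derivatives of the norm form at w,
  -- it would divide disc · w, hence w and then K.
  represented-lift : ∀ {p q} → Prime p → p ∣ q → ¬ (+ p ∣ℤ disc u v) → ¬ (+ p ∣ℤ K) →
                     Represented u v K q → Represented u v K (q ℕ.* p)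
  represented-lift {p} {q} p-prime p∣q p∤D p∤K ((a , c) , w≈K)
    with + p ℤ∣.∣? ∂₁ (a , c) | + p ℤ∣.∣? ∂₂ (a , c)
  ... | no p∤∂₁ | _ =
    shift₁ a c (hensel-step p∣q (∂₁ (a , c)) 1ℤ (prime∤⇒invertible (∂₁ (a , c)) p-prime p∤∂₁) w≈K)
  ... | yes _ | no p∤∂₂ =
    shift₂ a c (hensel-step p∣q (∂₂ (a , c)) v (prime∤⇒invertible (∂₂ (a , c)) p-prime p∤∂₂) w≈K)
  ... | yes p∣∂₁ | yes p∣∂₂ = ⊥-elim (p∤K (≈0⇒∣ (begin
    K                 ≈⟨ ≈-mod-∣ p∣q w≈K ⟨
    norm u v (a , c)  ≈⟨ norm-≈0 u v (cancel-disc a p∣Da) (cancel-disc c p∣Dc) ⟩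
    0ℤ                ∎)))
    where
      open ≈-Reasoning p
      Da≡ : disc u v * a ≡ u * ∂₂ (a , c) - + 2 * v * ∂₁ (a , c)
      Da≡ = identity u v a c
        where
          identity : ∀ u v a c → (u * u - + 4 * v) * a ≡ u * (u * a + + 2 * v * c) - + 2 * v * (+ 2 * a + u * c)
          identity = solve-∀
      Dc≡ : disc u v * c ≡ u * ∂₁ (a , c) - + 2 * ∂₂ (a , c)
      Dc≡ = identity u v a c
        where
          identity : ∀ u v a c → (u * u - + 4 * v) * c ≡ u * (+ 2 * a + u * c) - + 2 * (u * a + + 2 * v * c)
          identity = solve-∀
      p∣Da : + p ∣ℤ disc u v * a
      p∣Da = subst (+ p ∣ℤ_) (sym Da≡) (ℤ∣.∣m∣n⇒∣m-n (ℤ∣.∣n⇒∣m*n u p∣∂₂) (ℤ∣.∣n⇒∣m*n (+ 2 * v) p∣∂₁))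
      p∣Dc : + p ∣ℤ disc u v * c
      p∣Dc = subst (+ p ∣ℤ_) (sym Dc≡) (ℤ∣.∣m∣n⇒∣m-n (ℤ∣.∣n⇒∣m*n u p∣∂₁) (ℤ∣.∣n⇒∣m*n (+ 2) p∣∂₂))
      cancel-disc : ∀ x → + p ∣ℤ disc u v * x → x ≈ 0ℤ [mod p ]
      cancel-disc x p∣Dx with euclidsLemmaℤ (disc u v) x p-prime p∣Dx
      ... | inj₁ p∣D = ⊥-elim (p∤D p∣D)
      ... | inj₂ p∣x = ∣⇒≈0 p∣x

represented-crt : ∀ {u v K p q} → InvertibleMod q (+ p) →
                  Represented u v K p → Represented u v K q → Represented u v K (q ℕ.* p)
represented-crt {u} {v} {K} {p} {q} p⁻¹ ((a₁ , c₁) , w₁≈K) ((a₂ , c₂) , w₂≈K) =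
  combine (crt-exists p⁻¹ a₁ a₂) (crt-exists p⁻¹ c₁ c₂)
  where
    combine : (∃ λ a → a ≈ a₁ [mod p ] × a ≈ a₂ [mod q ]) → (∃ λ c → c ≈ c₁ [mod p ] × c ≈ c₂ [mod q ]) →
              Represented u v K (q ℕ.* p)
    combine (a , a≈a₁ , a≈a₂) (c , c≈c₁ , c≈c₂) = (a , c) ,
      crt-unique p⁻¹ (≈-trans (norm-cong u v (vec-≈ a≈a₁ c≈c₁)) w₁≈K)
                     (≈-trans (norm-cong u v (vec-≈ a≈a₂ c≈c₂)) w₂≈K)

odd-prime : ∀ {p} → Prime p → p ≢ 2 → ∃ λ h → p ≡ suc (h ℕ.+ h)
odd-prime {p} p-prime p≢2 = from-parity (p ℕ.% 2) (m%n<n p 2) (m≡m%n+[m/n]*n p 2)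
  where
    from-parity : ∀ r → r < 2 → p ≡ r ℕ.+ p ℕ./ 2 ℕ.* 2 → ∃ λ h → p ≡ suc (h ℕ.+ h)
    from-parity 0 _ p≡2k with prime⇒irreducible p-prime (divides (p ℕ./ 2) p≡2k)
    ... | inj₁ ()
    ... | inj₂ 2≡p = ⊥-elim (p≢2 (sym 2≡p))
    from-parity 1 _ p≡2k+1 = h , trans p≡2k+1 (cong suc (trans (ℕ.*-comm h 2) (cong (h ℕ.+_) (ℕ.+-identityʳ h))))
      where h = p ℕ./ 2
    from-parity (suc (suc _)) (s≤s (s≤s ())) _

module _ {u v : ℤ} {N : ℕ} (adm : Admissible u v N) {K : ℤ} (K⁻¹ : InvertibleMod N K) where

  private
    prime∤disc : ∀ {p} → Prime p → p ∣ N → ¬ (+ p ∣ℤ disc u v)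
    prime∤disc p-prime p∣N = invertible⇒prime∤ (gcd≡1⇒invertible (disc u v) (Admissible.discCoprime adm)) p-prime p∣N

    prime∤K : ∀ {p} → Prime p → p ∣ N → ¬ (+ p ∣ℤ K)
    prime∤K = invertible⇒prime∤ K⁻¹

  represented-prime : ∀ {p} → Prime p → p ∣ N → Represented u v K p
  represented-prime {p} p-prime p∣N with p ℕ.≟ 2
  ... | yes refl = represented-mod2 u v K
  ... | no p≢2 with odd-prime p-prime p≢2
  ...   | h , refl = OddPrime.represented-oddPrime h p-prime u v K (prime∤disc p-prime p∣N)

  represented-product : ∀ ps → All Prime ps → product ps ∣ N → Represented u v K (product ps)
  represented-product [] [] _ = (0ℤ , 0ℤ) , ≈[mod1] _ K
  represented-product (p ∷ ps) (p-prime ∷ ps-prime) pps∣N =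
    subst (Represented u v K) (ℕ.*-comm (product ps) p) (extend (p ∣? product ps))
    where
      p∣N = m*n∣⇒m∣ p (product ps) pps∣N
      IH = represented-product ps ps-prime (m*n∣⇒n∣ p (product ps) pps∣N)
      extend : Dec (p ∣ product ps) → Represented u v K (product ps ℕ.* p)
      extend (yes p∣q) = represented-lift {u} {v} {K} p-prime p∣q (prime∤disc p-prime p∣N) (prime∤K p-prime p∣N) IH
      extend (no p∤q)  = represented-crt {u} {v} {K} (gcd≡1⇒invertible (+ p) (prime∤⇒gcd≡1 p-prime p∤q))
                                         (represented-prime p-prime p∣N) IH

  represented-modulus : 0 < N → Represented u v K N
  represented-modulus 0<N with factorise N {{ℕ.>-nonZero 0<N}}
  ... | record { factors = ps ; isFactorisation = N≡∏ps ; factorsPrime = ps-prime } =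
    subst (Represented u v K) (sym N≡∏ps) (represented-product ps ps-prime (subst (_∣ N) N≡∏ps ∣-refl))

norm-onto-units : ∀ {u v N} → Admissible u v N → 0 < N → ∀ {K} → InvertibleMod N K →
                  ∃ λ (x : P1Q) → cuspNorm u v x ≈ K [mod N ]
norm-onto-units {u} {v} {N} adm 0<N {K} K⁻¹ = lift (represented-modulus adm K⁻¹ 0<N)
  where
    lift : Represented u v K N → ∃ λ (x : P1Q) → cuspNorm u v x ≈ K [mod N ]
    lift ((a , c) , ac≈K) = toCusp (primitive-lift 0<N a c no-common-prime)
      where
        no-common-prime : ∀ p → Prime p → p ∣ N → + p ∣ℤ a → + p ∣ℤ c → ⊥
        no-common-prime p p-prime p∣N p∣a p∣c = invertible⇒prime∤ K⁻¹ p-prime p∣N (≈0⇒∣ (begin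
          K                  ≈⟨ ≈-mod-∣ p∣N ac≈K ⟨
          norm u v (a , c)   ≈⟨ norm-≈0 u v (∣⇒≈0 p∣a) (∣⇒≈0 p∣c) ⟩
          0ℤ                 ∎))
          where open ≈-Reasoning p
        toCusp : (∃ λ w → Primitive w × w ≈ᵥ (a , c) [mod N ]) → ∃ λ (x : P1Q) → cuspNorm u v x ≈ K [mod N ]
        toCusp ((a' , c') , prim , w≈) = pt a' c' prim , ≈-trans (norm-cong u v w≈) ac≈K

private
  index-∈-lookup : ∀ (L : List ℕ) i → index (∈-lookup {xs = L} i) ≡ i
  index-∈-lookup (_ ∷ _) Fin.zero    = refl
  index-∈-lookup (_ ∷ L) (Fin.suc i) = cong Fin.suc (index-∈-lookup L i)

  index-cong : ∀ {L : List ℕ} → Unique L → ∀ {k k'} → k ≡ k' → (p : k ∈ L) (q : k' ∈ L) → index p ≡ index q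
  index-cong L! refl p q = cong index (Membership.unique⇒irrelevant (setoid ℕ) ℕ.≡-irrelevant L! p q)

-- Counting cusps

numCusps-fromInvariant : ∀ {H} (L : List ℕ) → Unique L → (r : P1Q → ℕ) →
                         (∀ x → r x ∈ L) → (∀ k → k ∈ L → ∃ λ x → r x ≡ k) →
                         (∀ x y → r x ≡ r y ⇔ SameCusp H x y) → NumCusps H (length L)
numCusps-fromInvariant {H} L L! r r∈L onto r-complete = f , f-onto , λ x y → mk⇔ (to x y) (from x y)
  where
    f : P1Q → Fin (length L)
    f x = index (r∈L x)
    f-onto : ∀ i → ∃ λ x → f x ≡ i
    f-onto i with onto (lookup L i) (∈-lookup i)
    ... | x , rx≡ = x , trans (index-cong L! rx≡ (r∈L x) (∈-lookup i)) (index-∈-lookup L i)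
    to : ∀ x y → f x ≡ f y → SameCusp H x y
    to x y fx≡fy = Equivalence.to (r-complete x y) (Membership.index-injective (setoid ℕ) (r∈L x) (r∈L y) fx≡fy)
    from : ∀ x y → SameCusp H x y → f x ≡ f y
    from x y same = index-cong L! (Equivalence.from (r-complete x y) same) (r∈L x) (r∈L y)

module _ {P Q : Pred ℕ 0ℓ} (P? : Decidable P) (Q? : Decidable Q) where

  length-filter-split : ∀ xs → length (filter P? xs) ≡
    length (filter (λ x → P? x ×-dec Q? x) xs) ℕ.+ length (filter (λ x → P? x ×-dec ¬? (Q? x)) xs)
  length-filter-split [] = refl
  length-filter-split (x ∷ xs) with does (P? x) | does (Q? x) | length-filter-split xs
  ... | false | _     | ih = ih
  ... | true  | true  | ih = cong suc ih
  ... | true  | false | ih = trans (cong suc ih) (sym (ℕ.+-suc _ _))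

  private
    length-filter-∷ : ∀ {R : Pred ℕ 0ℓ} (R? : Decidable R) x xs →
                      length (filter R? (x ∷ xs)) ≡ length (filter R? (x ∷ [])) ℕ.+ length (filter R? xs)
    length-filter-∷ R? x xs with does (R? x)
    ... | true  = refl
    ... | false = refl

    length-filter-∷ʳ : ∀ {R : Pred ℕ 0ℓ} (R? : Decidable R) xs x →
                       length (filter R? (xs ∷ʳ x)) ≡ length (filter R? xs) ℕ.+ length (filter R? (x ∷ []))
    length-filter-∷ʳ R? xs x = trans (cong length (filter-++ R? xs (x ∷ []))) (length-++ (filter R? xs))

    length-filter-singleton : ∀ x y → P x ⇔ Q y → length (filter P? (x ∷ [])) ≡ length (filter Q? (y ∷ []))
    length-filter-singleton x y P⇔Q with P? x | Q? y
    ... | yes _  | yes _  = refl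
    ... | no _   | no _   = refl
    ... | yes px | no ¬qy = ⊥-elim (¬qy (Equivalence.to P⇔Q px))
    ... | no ¬px | yes qy = ⊥-elim (¬px (Equivalence.from P⇔Q qy))

  -- Counting P along f 0, …, f (m - 1) is counting Q along g (m - 1), …, g 0.
  length-filter-reversed : ∀ f g m → (∀ i → i < m → P (f i) ⇔ Q (g (m ∸ suc i))) →
                           length (filter P? (applyUpTo f m)) ≡ length (filter Q? (applyUpTo g m))
  length-filter-reversed f g zero    _   = refl
  length-filter-reversed f g (suc m) P⇔Q = begin
    length (filter P? (applyUpTo f (suc m)))                         ≡⟨ length-filter-∷ P? (f 0) _ ⟩
    length (filter P? (f 0 ∷ [])) ℕ.+ length (filter P? (applyUpTo (f ∘ suc) m))
      ≡⟨ cong₂ ℕ._+_ (length-filter-singleton (f 0) (g m) (P⇔Q 0 (s≤s ℕ.z≤n)))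
                   (length-filter-reversed (f ∘ suc) g m (λ i i<m → P⇔Q (suc i) (s≤s i<m))) ⟩
    length (filter Q? (g m ∷ [])) ℕ.+ length (filter Q? (applyUpTo g m))
      ≡⟨ ℕ.+-comm (length (filter Q? (g m ∷ []))) _ ⟩
    length (filter Q? (applyUpTo g m)) ℕ.+ length (filter Q? (g m ∷ []))
      ≡⟨ length-filter-∷ʳ Q? (applyUpTo g m) (g m) ⟨
    length (filter Q? (applyUpTo g m ∷ʳ g m))
      ≡⟨ cong (length ∘ filter Q?) (applyUpTo-∷ʳ g m) ⟩
    length (filter Q? (applyUpTo g (suc m)))
      ∎
    where open ≡-Reasoning

module _ (N : ℕ) where

  Unit : ℕ → Set
  Unit k = gcd k N ≡ 1

  Small : ℕ → Set
  Small k = 2 ℕ.* k < N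

  smallUnits : List ℕ
  smallUnits = filter (λ k → (gcd k N ℕ.≟ 1) ×-dec (2 ℕ.* k <? N)) (upTo N)

  unit-complement : ∀ j k → j ℕ.+ k ≡ N → Unit k → Unit j
  unit-complement j k j+k≡N gcd≡1 = ∣1⇒≡1 (subst (gcd j N ∣_) gcd≡1 (gcd-greatest g∣k (gcd[m,n]∣n j N)))
    where
      g∣k : gcd j N ∣ k
      g∣k = ∣m+n∣m⇒∣n (subst (gcd j N ∣_) (sym j+k≡N) (gcd[m,n]∣n j N)) (gcd[m,n]∣m j N)

  fold : ℕ → ℕ
  fold k = k ⊓ (N ∸ k)

  fold-complement : ∀ k → k ≤ N → fold (N ∸ k) ≡ fold k
  fold-complement k k≤N = trans (cong ((N ∸ k) ⊓_) (ℕ.m∸[m∸n]≡n k≤N)) (ℕ.⊓-comm (N ∸ k) k)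

  fold-injective : ∀ k k' → k ≤ N → k' ≤ N → fold k ≡ fold k' → k' ≡ k ⊎ k' ≡ N ∸ k
  fold-injective k k' k≤N k'≤N f≡f' with ℕ.⊓-sel k (N ∸ k) | ℕ.⊓-sel k' (N ∸ k')
  ... | inj₁ f≡k   | inj₁ f'≡k'   = inj₁ (trans (sym f'≡k') (trans (sym f≡f') f≡k))
  ... | inj₁ f≡k   | inj₂ f'≡N-k' =
    inj₂ (trans (sym (ℕ.m∸[m∸n]≡n k'≤N)) (cong (N ∸_) (trans (sym f'≡N-k') (trans (sym f≡f') f≡k))))
  ... | inj₂ f≡N-k | inj₁ f'≡k'   = inj₂ (trans (sym f'≡k') (trans (sym f≡f') f≡N-k))
  ... | inj₂ f≡N-k | inj₂ f'≡N-k' = inj₁ (sym (ℕ.∸-cancelˡ-≡ k≤N k'≤N (trans (sym f≡N-k) (trans f≡f' f'≡N-k'))))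

  fold-small : ∀ k → Small k → fold k ≡ k
  fold-small k 2k<N = ℕ.m≤n⇒m⊓n≡m (ℕ.m+n≤o⇒m≤o∸n k k+k≤N)
    where
      k+k≤N : k ℕ.+ k ≤ N
      k+k≤N = ℕ.≤-trans (ℕ.≤-reflexive (cong (k ℕ.+_) (sym (ℕ.+-identityʳ k)))) (ℕ.<⇒≤ 2k<N)

  module _ (2<N : 2 < N) where

    unit≢half : ∀ k → Unit k → 2 ℕ.* k ≢ N
    unit≢half k gcd≡1 2k≡N = ℕ.<-irrefl (trans (cong (2 ℕ.*_) (sym k≡1)) 2k≡N) 2<N
      where
        k≡1 : k ≡ 1
        k≡1 = ∣1⇒≡1 (subst (k ∣_) gcd≡1 (gcd-greatest ∣-refl (divides 2 (sym 2k≡N))))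

    private
      doubled : ∀ {j k} → j ℕ.+ k ≡ N → 2 ℕ.* j ℕ.+ 2 ℕ.* k ≡ N ℕ.+ N
      doubled {j} {k} j+k≡N =
        trans (sym (ℕ.*-distribˡ-+ 2 j k)) (trans (cong (2 ℕ.*_) j+k≡N) (cong (N ℕ.+_) (ℕ.+-identityʳ N)))

    ¬small∧small : ∀ j k → j ℕ.+ k ≡ N → Small j → Small k → ⊥
    ¬small∧small j k j+k≡N 2j<N 2k<N = ℕ.<-irrefl (doubled {j} {k} j+k≡N) (ℕ.+-mono-< 2j<N 2k<N)

    large-complement : ∀ j k → j ℕ.+ k ≡ N → Unit k → ¬ Small j → Small k
    large-complement j k j+k≡N k-unit 2j≮N = ℕ.≤∧≢⇒< 2k≤N (unit≢half k k-unit)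
      where
        2k≤N : 2 ℕ.* k ≤ N
        2k≤N = ℕ.+-cancelˡ-≤ N (2 ℕ.* k) N
                 (subst (N ℕ.+ 2 ℕ.* k ≤_) (doubled {j} {k} j+k≡N) (ℕ.+-monoˡ-≤ (2 ℕ.* k) (ℕ.≮⇒≥ 2j≮N)))

    complement-swaps-halves : ∀ j k → j ℕ.+ k ≡ N → (Unit j × ¬ Small j) ⇔ (Unit k × Small k)
    complement-swaps-halves j k j+k≡N = mk⇔
      (λ (j-unit , 2j≮N) → let k-unit = unit-complement k j (trans (ℕ.+-comm k j) j+k≡N) j-unit
                           in k-unit , large-complement j k j+k≡N k-unit 2j≮N)
      (λ (k-unit , 2k<N) → unit-complement j k j+k≡N k-unit , λ 2j<N → ¬small∧small j k j+k≡N 2j<N 2k<N)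

    fold-unit : ∀ k → k ≤ N → Unit k → Unit (fold k) × Small (fold k)
    fold-unit k k≤N k-unit = f-unit , ℕ.≤∧≢⇒< 2f≤N (unit≢half (fold k) f-unit)
      where
        f-unit : Unit (fold k)
        f-unit with ℕ.⊓-sel k (N ∸ k)
        ... | inj₁ f≡k   = subst Unit (sym f≡k) k-unit
        ... | inj₂ f≡N-k = subst Unit (sym f≡N-k) (unit-complement (N ∸ k) k (ℕ.m∸n+n≡m k≤N) k-unit)
        2f≤N : 2 ℕ.* fold k ≤ N
        2f≤N = begin
          2 ℕ.* fold k               ≡⟨ cong (fold k ℕ.+_) (ℕ.+-identityʳ (fold k)) ⟩
          fold k ℕ.+ fold k          ≤⟨ ℕ.+-mono-≤ (ℕ.m⊓n≤m k (N ∸ k)) (ℕ.m⊓n≤n k (N ∸ k)) ⟩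
          k ℕ.+ (N ∸ k)              ≡⟨ ℕ.m+[n∸m]≡n k≤N ⟩
          N                        ∎
          where open ℕ.≤-Reasoning

-- For N > 2 the units come in pairs {k, N - k}, exactly one of which is below N / 2.
φ≡twice-smallUnits : ∀ m → 2 < suc m → φ (suc m) ≡ length (smallUnits (suc m)) ℕ.+ length (smallUnits (suc m))
φ≡twice-smallUnits m 2<N = begin
  φ N
    ≡⟨ cong length (filter-reject Unit? {x = 0} {xs = rest} ¬unit-0) ⟩
  length (filter Unit? rest)
    ≡⟨ length-filter-split Unit? Small? rest ⟩
  length (filter Unit∩Small? rest) ℕ.+ length (filter Unit∩Large? rest)
    ≡⟨ cong (length (filter Unit∩Small? rest) ℕ.+_)
            (length-filter-reversed Unit∩Large? Unit∩Small? suc suc m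
              (λ i i<m → complement-swaps-halves N 2<N (suc i) (suc (m ∸ suc i)) (complement i i<m))) ⟩
  length (filter Unit∩Small? rest) ℕ.+ length (filter Unit∩Small? rest)
    ≡⟨ cong₂ ℕ._+_ drop-0 drop-0 ⟨
  length (smallUnits N) ℕ.+ length (smallUnits N)
    ∎
  where
    open ≡-Reasoning
    N = suc m
    rest = applyUpTo suc m
    Unit? = λ k → gcd k N ℕ.≟ 1
    Small? = λ k → 2 ℕ.* k <? N
    Unit∩Small? = λ k → Unit? k ×-dec Small? k
    Unit∩Large? = λ k → Unit? k ×-dec ¬? (Small? k)
    ¬unit-0 : ¬ Unit N 0
    ¬unit-0 N≡1 = ℕ.<⇒≱ 2<N (ℕ.≤-trans (ℕ.≤-reflexive (trans (sym (gcd-identityˡ N)) N≡1)) (s≤s z≤n))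
    drop-0 : length (smallUnits N) ≡ length (filter Unit∩Small? rest)
    drop-0 = cong length (filter-reject Unit∩Small? {x = 0} {xs = rest} (¬unit-0 ∘ proj₁))
    complement : ∀ i → i < m → suc i ℕ.+ suc (m ∸ suc i) ≡ N
    complement i i<m = trans (ℕ.+-suc (suc i) (m ∸ suc i)) (cong suc (ℕ.m+[n∸m]≡n i<m))

φ/2≡smallUnits : ∀ m → 2 < suc m → φ (suc m) / 2 ≡ length (smallUnits (suc m))
φ/2≡smallUnits m 2<N = begin
  φ (suc m) / 2     ≡⟨ cong (_/ 2) (φ≡twice-smallUnits m 2<N) ⟩
  (ℓ ℕ.+ ℓ) / 2       ≡⟨ cong (λ t → (ℓ ℕ.+ t) / 2) (ℕ.+-identityʳ ℓ) ⟨
  (2 ℕ.* ℓ) / 2       ≡⟨ cong (_/ 2) (ℕ.*-comm 2 ℓ) ⟩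
  (ℓ ℕ.* 2) / 2       ≡⟨ m*n/n≡m ℓ 2 ⟩
  ℓ                 ∎
  where
    open ≡-Reasoning
    ℓ = length (smallUnits (suc m))

module _ {u v : ℤ} {N' : ℕ} (adm : Admissible u v (suc N')) where

  private
    N = suc N'

    residue : P1Q → ℕ
    residue x = cuspNorm u v x %ℕ N

    invertible-cuspNorm : ∀ x → InvertibleMod N (cuspNorm u v x)
    invertible-cuspNorm x = primitive⇒norm-invertible adm (vec x) (prim x)

    residue<N : ∀ x → residue x < N
    residue<N x = n%ℕd<d (cuspNorm u v x) N

    residue-unit : ∀ x → Unit N (residue x)
    residue-unit x = invertible⇒gcd≡1 (+ residue x)
      (invertible-resp-≈ (≈-sym (≈-%ℕ (cuspNorm u v x))) (invertible-cuspNorm x))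

    residue-onto-units : ∀ k → k < N → Unit N k → ∃ λ x → residue x ≡ k
    residue-onto-units k k<N k-unit = lift (norm-onto-units adm (s≤s z≤n) (gcd≡1⇒invertible (+ k) k-unit))
      where
        lift : (∃ λ x → cuspNorm u v x ≈ + k [mod N ]) → ∃ λ x → residue x ≡ k
        lift (x , x≈k) = x , trans (≈⇒%ℕ≡ x≈k) (small-%ℕ k<N)

    residue-complete : ∀ x y → residue x ≡ residue y ⇔ SameCusp (InCns u v N) x y
    residue-complete x y = mk⇔
      (λ rx≡ry → norm≈⇒sameCusp {u} {v} {N} {x} {y} (invertible-cuspNorm x) (≈-sym (%ℕ≡⇒≈ rx≡ry)))
      (λ same → sym (≈⇒%ℕ≡ (sameCusp⇒norm≈ {u} {v} {N} {x} {y} same)))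

    residue-neg : 1 < N → ∀ x → (- cuspNorm u v x) %ℕ N ≡ N ∸ residue x
    residue-neg 1<N x = neg-%ℕ (cuspNorm u v x) (ℕ.n≢0⇒n>0 λ r≡0 → ¬unit-0 (subst (Unit N) r≡0 (residue-unit x)))
      where
        ¬unit-0 : ¬ Unit N 0
        ¬unit-0 N≡1 = ℕ.<-irrefl (sym (trans (sym (gcd-identityˡ N)) N≡1)) 1<N

  cusps-Cns : NumCusps (InCns u v N) (φ N)
  cusps-Cns = numCusps-fromInvariant units (filter⁺ Unit? (upTo⁺ N)) residue
    (λ x → ∈-filter⁺ Unit? (∈-upTo⁺ (residue<N x)) (residue-unit x))
    (λ k k∈units → let k<N , k-unit = ∈-filter⁻ Unit? {xs = upTo N} k∈units
                   in residue-onto-units k (∈-upTo⁻ k<N) k-unit)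
    residue-complete
    where
      Unit? = λ k → gcd k N ℕ.≟ 1
      units = filter Unit? (upTo N)

  cusps-Cns⁺ : 2 < N → NumCusps (InCns⁺ u v N) (φ N / 2)
  cusps-Cns⁺ 2<N = subst (NumCusps (InCns⁺ u v N)) (sym (φ/2≡smallUnits N' 2<N))
    (numCusps-fromInvariant (smallUnits N) (filter⁺ Unit∩Small? (upTo⁺ N))
                            residue⁺ residue⁺∈ residue⁺-onto residue⁺-complete)
    where
      Unit∩Small? = λ k → (gcd k N ℕ.≟ 1) ×-dec (2 ℕ.* k ℕ.<? N)
      1<N = ℕ.<-trans (s≤s (s≤s z≤n)) 2<N
      residue⁺ : P1Q → ℕ
      residue⁺ x = fold N (residue x)

      residue⁺∈ : ∀ x → residue⁺ x ∈ smallUnits N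
      residue⁺∈ x = ∈-filter⁺ Unit∩Small? (∈-upTo⁺ (ℕ.≤-<-trans (ℕ.m≤m+n _ _) small)) (unit , small)
        where
          unit-small = fold-unit N 2<N (residue x) (ℕ.<⇒≤ (residue<N x)) (residue-unit x)
          unit = proj₁ unit-small
          small = proj₂ unit-small

      residue⁺-onto : ∀ k → k ∈ smallUnits N → ∃ λ x → residue⁺ x ≡ k
      residue⁺-onto k k∈ = lift (residue-onto-units k (∈-upTo⁻ k<N) k-unit)
        where
          k-spec = ∈-filter⁻ Unit∩Small? {xs = upTo N} k∈
          k<N = proj₁ k-spec
          k-unit = proj₁ (proj₂ k-spec)
          lift : (∃ λ x → residue x ≡ k) → ∃ λ x → residue⁺ x ≡ k
          lift (x , rx≡k) = x , trans (cong (fold N) rx≡k) (fold-small N k (proj₂ (proj₂ k-spec)))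

      residue⁺-complete : ∀ x y → residue⁺ x ≡ residue⁺ y ⇔ SameCusp (InCns⁺ u v N) x y
      residue⁺-complete x y = mk⇔ to from
        where
          to : residue⁺ x ≡ residue⁺ y → SameCusp (InCns⁺ u v N) x y
          to fx≡fy = [ same-residue , opposite-residue ]′
            (fold-injective N (residue x) (residue y) (ℕ.<⇒≤ (residue<N x)) (ℕ.<⇒≤ (residue<N y)) fx≡fy)
            where
              same-residue : residue y ≡ residue x → SameCusp (InCns⁺ u v N) x y
              same-residue ry≡rx =
                sameCusp-Cns⇒Cns⁺ {u} {v} {N} {x} {y} (Equivalence.to (residue-complete x y) (sym ry≡rx))
              opposite-residue : residue y ≡ N ∸ residue x → SameCusp (InCns⁺ u v N) x y
              opposite-residue ry≡N-rx = norm≈-⇒sameCusp⁺ {u} {v} {N} {x} {y} (invertible-cuspNorm x)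
                                           (%ℕ≡⇒≈ (trans ry≡N-rx (sym (residue-neg 1<N x))))
          from : SameCusp (InCns⁺ u v N) x y → residue⁺ x ≡ residue⁺ y
          from same = [ same-norm , opposite-norm ]′ (sameCusp⁺⇒norm≈± {u} {v} {N} {x} {y} same)
            where
              same-norm : cuspNorm u v y ≈ cuspNorm u v x [mod N ] → residue⁺ x ≡ residue⁺ y
              same-norm y≈x = cong (fold N) (sym (≈⇒%ℕ≡ y≈x))
              opposite-norm : cuspNorm u v y ≈ - cuspNorm u v x [mod N ] → residue⁺ x ≡ residue⁺ y
              opposite-norm y≈-x = trans (sym (fold-complement N (residue x) (ℕ.<⇒≤ (residue<N x))))
                                         (cong (fold N) (trans (sym (residue-neg 1<N x)) (sym (≈⇒%ℕ≡ y≈-x))))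

cusps-Cns⁺-2 : ∀ {u v} → Admissible u v 2 → NumCusps (InCns⁺ u v 2) 1
cusps-Cns⁺-2 {u} {v} adm =
  (λ _ → Fin.zero) , (λ { Fin.zero → pt 1ℤ 0ℤ refl , refl }) , λ x y → mk⇔ (to x y) (λ _ → refl)
  where
    -- φ 2 computes to 1.
    single : (i j : Fin (φ 2)) → i ≡ j
    single Fin.zero Fin.zero = refl
    f = proj₁ (cusps-Cns adm)
    to : ∀ x y → Fin.zero ≡ Fin.zero → SameCusp (InCns⁺ u v 2) x y
    to x y _ = sameCusp-Cns⇒Cns⁺ {u} {v} {2} {x} {y}
                 (Equivalence.to (proj₂ (proj₂ (cusps-Cns adm)) x y) (single (f x) (f y)))

proposition4p2 : (N : ℕ) → 0 < N → (u v : ℤ) → Admissible u v N →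
    NumCusps (InCns u v N) (φ N) ×
    (N ≡ 2 → NumCusps (InCns⁺ u v N) 1) ×
    (2 < N → NumCusps (InCns⁺ u v N) (φ N / 2))
proposition4p2 (suc N') _ u v adm = cusps-Cns adm , (λ { refl → cusps-Cns⁺-2 adm }) , cusps-Cns⁺ adm
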